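{- For every $m\ge 1$ and every $\alpha=(\alpha_1,\dots,\alpha_m)\in\mathbb Z^m$, \[\psi(\mathfrak S_\alpha)=\mathbb B^{rs}_{\alpha_1}\cdots\mathbb B^{rs}_{\alpha_m}(1).\]
   Context: $\mathrm{NSym}=\mathbb Q\langle\mathbf e_1,\mathbf e_2,\dots\rangle$ (noncommuting generators, $\deg\mathbf e_n=n$, $\mathbf e_0=1$, $\mathbf e_n=0$ for $n<0$), $\mathbf h_n=\sum_{\beta\vDash n}(-1)^{n-\ell(\beta)}\mathbf e_{\beta_1}\cdots\mathbf e_{\beta_{\ell(\beta)}}$, $\mathbf h_0=1$, $\mathbf h_n=0$ for $n<0$. $\mathrm{QSym}$ has fundamental basis $F_\alpha$; $\mathrm{NSym}$ and $\mathrm{QSym}$ are dual under the pairing with $\langle\mathbf r_\alpha,F_\beta\rangle=\delta_{\alpha\beta}$, where $\mathbf r_\alpha=\sum_{\beta\text{ coarsening }\alpha}(-1)^{\ell(\alpha)-\ell(\beta)}\mathbf h_\beta$. For $F\in\mathrm{QSym}$, $F^\perp$ is the operator on $\mathrm{NSym}$ adjoint to multiplication by $F$: $\langle F^\perp(a),b\rangle=\langle a,Fb\rangle$; $F_{(0)}=F_{(1^0)}=1$. For $m\in\mathbb Z$ define operators on $\mathrm{NSym}$ \[\mathbb B_m=\sum_{i\ge0}(-1)^i\mathbf h_{m+i}F^\perp_{(1^i)},\qquad \mathbb B^{rs}_m=\sum_{i\ge0}(-1)^i\mathbf e_{m+i}F^\perp_{(i)}\] (where $\mathbf h_{m+i}F^\perp$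 means $f\mapsto\mathbf h_{m+i}\cdot F^\perp(f)$, left multiplication), and for $\alpha\in\mathbb Z^m$ the immaculate function $\mathfrak S_\alpha=\mathbb B_{\alpha_1}\cdots\mathbb B_{\alpha_m}(1)$. $\psi$ is the algebra automorphism of $\mathrm{NSym}$ with $\psi(\mathbf h_n)=\mathbf e_n$ (equivalently $\psi(\mathbf r_\alpha)=\mathbf r_{\alpha^c}$). -}

module Defs where

open import Data.Nat as ℕ using (ℕ; zero; suc; _∸_; _⊔_)
open import Data.Integer as ℤ using (ℤ; +_; -[1+_])
open import Data.Rational as ℚ using (ℚ; 0ℚ; 1ℚ)
open import Data.List using (List; []; _∷_; _++_; map; concatMap; foldr; length; upTo; replicate)
open import Data.List.Properties using (≡-dec)
open import Data.Product using (_×_; _,_)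
open import Data.Vec as Vec using (Vec)
open import Relation.Binary.PropositionalEquality using (_≡_)
open import Relation.Nullary using (yes; no)

-- A composition (β₁,…,βₗ) with all βⱼ ≥ 1 is encoded as the list
-- (β₁ - 1, …, βₗ - 1) of naturals ("shifted encoding").  Hence every
-- List ℕ is a valid composition, and [] is the empty composition (of 0).

Comp : Set
Comp = List ℕ

size : Comp → ℕ
size β = foldr (λ k acc → suc k ℕ.+ acc) 0 β

_≟c_ : (α β : Comp) → Relation.Nullary.Dec (α ≡ β)
_≟c_ = ≡-dec ℕ._≟_

comps : ℕ → List Comp
comps zero = [] ∷ []
comps (suc n) = concatMap ext (comps n)
  where
  ext : Comp → List Comp
  ext [] = (0 ∷ []) ∷ []
  ext (a ∷ γ) = (0 ∷ a ∷ γ) ∷ (suc a ∷ γ) ∷ []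

coarsenings : Comp → List Comp
coarsenings [] = [] ∷ []
coarsenings (a ∷ α) = concatMap step (coarsenings α)
  where
  step : Comp → List Comp
  step [] = (a ∷ []) ∷ []
  step (b ∷ γ) = (a ∷ b ∷ γ) ∷ (suc (a ℕ.+ b) ∷ γ) ∷ []

refinements : Comp → List Comp
refinements [] = [] ∷ []
refinements (a ∷ α) =
  concatMap (λ γ → map (λ δ → γ ++ δ) (refinements α)) (comps (suc a))

sgn : ℕ → ℚ
sgn zero = 1ℚ
sgn (suc n) = ℚ.- sgn n

-- NSym = ℚ⟨e₁,e₂,…⟩ : finite formal ℚ-linear combinations of words in the
-- generators.  A word e_{β₁}⋯e_{βₗ} is encoded by the composition β
-- (shifted encoding), so the empty word is 1.

NSym : Set
NSym = List (ℚ × Comp)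

coeff : Comp → NSym → ℚ
coeff w = foldr step 0ℚ
  where
  step : ℚ × Comp → ℚ → ℚ
  step (c , u) acc with w ≟c u
  ... | yes _ = c ℚ.+ acc
  ... | no _ = acc

_≈_ : NSym → NSym → Set
a ≈ b = ∀ w → coeff w a ≡ coeff w b

infix 4 _≈_

zeroN : NSym
zeroN = []

oneN : NSym
oneN = (1ℚ , []) ∷ []

_+N_ : NSym → NSym → NSym
_+N_ = _++_

scaleN : ℚ → NSym → NSym
scaleN c = map (λ { (d , w) → (c ℚ.* d , w) })

_*N_ : NSym → NSym → NSym
a *N b = concatMap (λ { (c , u) → map (λ { (d , v) → (c ℚ.* d , u ++ v) }) b }) a

sumN : List NSym → NSym
sumN = foldr _+N_ zeroN

infixl 6 _+N_
infixl 7 _*N_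

e : ℤ → NSym
e (+ zero) = oneN
e (+ suc k) = (1ℚ , k ∷ []) ∷ []
e -[1+ _ ] = zeroN

h : ℤ → NSym
h (+ zero) = oneN
h (+ suc k) = map (λ β → (sgn (suc k ∸ length β) , β)) (comps (suc k))
h -[1+ _ ] = zeroN

hComp : Comp → NSym
hComp [] = oneN
hComp (b ∷ β) = h (+ suc b) *N hComp β

r : Comp → NSym
r α = sumN (map (λ β → scaleN (sgn (length α ∸ length β)) (hComp β)) (coarsenings α))

-- degree bound of a representative (max word size)
deg : NSym → ℕ
deg = foldr (λ { (c , w) acc → size w ⊔ acc }) 0

-- QSym : finite ℚ-linear combinations of monomial quasisymmetric
-- functions M_γ, with the quasi-shuffle (stuffle) product.

QSym : Set
QSym = List (ℚ × Comp)

-- quasi-shuffles of two compositions (shifted encoding: merging parts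
-- a+1 and b+1 gives a+b+2, encoded a+b+1)
qsh : Comp → Comp → List Comp
qsh [] v = v ∷ []
qsh (a ∷ u) [] = (a ∷ u) ∷ []
qsh (a ∷ u) (b ∷ v) =
  map (a ∷_) (qsh u (b ∷ v)) ++
  map (b ∷_) (qsh (a ∷ u) v) ++
  map (suc (a ℕ.+ b) ∷_) (qsh u v)

_*Q_ : QSym → QSym → QSym
f *Q g = concatMap (λ { (c , α) → concatMap (λ { (d , β) → map (λ γ → (c ℚ.* d , γ)) (qsh α β) }) g }) f

F : Comp → QSym
F β = map (λ γ → (1ℚ , γ)) (refinements β)

ones : ℕ → Comp
ones i = replicate i 0

row : ℕ → Comp
row zero = []
row (suc k) = k ∷ []

-- The pairing NSym × QSym → ℚ.  It is determined by its values
-- p w γ = ⟨e_w , M_γ⟩ on basis elements, extended bilinearly.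

pairing : (Comp → Comp → ℚ) → NSym → QSym → ℚ
pairing p a g =
  foldr (λ { (c , w) acc →
    foldr (λ { (d , γ) acc' → (c ℚ.* d ℚ.* p w γ) ℚ.+ acc' }) 0ℚ g ℚ.+ acc }) 0ℚ a

δ : Comp → Comp → ℚ
δ α β with α ≟c β
... | yes _ = 1ℚ
... | no _ = 0ℚ

IsDualPairing : (Comp → Comp → ℚ) → Set
IsDualPairing p = ∀ α β → pairing p (r α) (F β) ≡ δ α β

IsPerp : (Comp → Comp → ℚ) → (QSym → NSym → NSym) → Set
IsPerp p perp = ∀ (f : QSym) (a : NSym) (b : QSym) →
  pairing p (perp f a) b ≡ pairing p a (f *Q b)

record IsPsi (ψ : NSym → NSym) : Set where
  field
    resp  : ∀ {a b} → a ≈ b → ψ a ≈ ψ b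
    add   : ∀ a b → ψ (a +N b) ≈ ψ a +N ψ b
    scale : ∀ c a → ψ (scaleN c a) ≈ scaleN c (ψ a)
    mult  : ∀ a b → ψ (a *N b) ≈ ψ a *N ψ b
    unit  : ψ oneN ≈ oneN
    onH   : ∀ n → ψ (h n) ≈ e n
    bij   : ∀ b → Data.Product.Σ NSym (λ a → ψ a ≈ b)
    inj   : ∀ a b → ψ a ≈ ψ b → a ≈ b

-- The creation operators.  The sum over i ≥ 0 is truncated at deg a,
-- since F^⊥_G kills elements of degree < |G|.

𝔹 : (QSym → NSym → NSym) → ℤ → NSym → NSym
𝔹 perp m a = sumN (map (λ i → scaleN (sgn i) (h (m ℤ.+ + i) *N perp (F (ones i)) a)) (upTo (suc (deg a))))

𝔹rs : (QSym → NSym → NSym) → ℤ → NSym → NSym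
𝔹rs perp m a = sumN (map (λ i → scaleN (sgn i) (e (m ℤ.+ + i) *N perp (F (row i)) a)) (upTo (suc (deg a))))

applyAll : (ℤ → NSym → NSym) → {m : ℕ} → Vec ℤ m → NSym
applyAll B α = foldr B oneN (Vec.toList α)

immaculate : (QSym → NSym → NSym) → {m : ℕ} → Vec ℤ m → NSym
immaculate perp α = applyAll (𝔹 perp) α

{-# OPTIONS --safe #-}
module Submission where

-- ψ is an algebra map with ψ(h_n) = e_n, and ψ(e_n) = h_n because h and e satisfy the same
-- defining relation with their roles exchanged.  Hence the theorem follows by induction on α
-- from ψ ∘ F_(1^i)^⊥ = F_(i)^⊥ ∘ ψ.  Both F_(1^i) and F_(i) are divided-power sequences
-- (Δ G_i = Σ_{a+b=i} G_a ⊗ G_b), so both skewing operators satisfy the same Leibniz rule on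
-- products, and on generators F_(1^j)^⊥ e_n = e_{n-j}, F_(j)^⊥ h_n = h_{n-j}; induction on
-- words gives the intertwining.  Everything rests on computing the pairing from the axiom
-- ⟨r_α, F_β⟩ = δ_αβ: two Möbius inversions on the Boolean lattice of compositions give
-- ⟨h_u, M_γ⟩ = δ_uγ, which determines the pairing, shows it is nondegenerate (so F^⊥ is
-- determined by adjointness), and makes F^⊥ kill everything of degree below |F|, so the
-- truncation of the sums in 𝔹 and 𝔹rs is harmless.

open import Defs
open import Data.Nat using (ℕ; _≤_)
open import Data.Integer using (ℤ)
open import Data.Rational using (ℚ)
open import Data.Vec using (Vec)

open import Data.Bool using (Bool; true; false)
import Data.Bool.Properties as 𝔹P
open import Data.Empty using (⊥-elim)
import Data.Integer as ℤ
import Data.Integer.Properties as ℤP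
open import Data.List using (List; []; _∷_; _++_; map; concatMap; foldr; length; replicate; upTo; applyUpTo)
open import Data.List.Properties using (≡-dec; ∷-injective; ++-identityʳ; ++-assoc; length-replicate)
open import Data.Nat as ℕ using (zero; suc; _<_; z≤n; s≤s; _⊔_)
import Data.Nat.Properties as ℕP
open import Data.Nat.Induction using (<-wellFounded)
open import Induction.WellFounded using (Acc; acc)
open import Data.Nat.Solver using (module +-*-Solver)
open import Data.Product using (_×_; _,_; proj₁; proj₂)
open import Data.Rational as ℚ using (0ℚ; 1ℚ; _+_; _*_; -_)
import Data.Rational.Properties as ℚP
open import Data.Rational.Solver renaming (module +-*-Solver to ℚ-Solver)
import Data.Vec as Vec
open import Relation.Binary.PropositionalEquality
open import Relation.Nullary using (yes; no; ¬_)
open import Relation.Binary.Bundles using (Setoid)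
import Relation.Binary.Reasoning.Setoid
open import Level using (0ℓ)

open ℚ-Solver using (solve; _:+_; _:*_; :-_; _:=_; con)

module Sums where

  ∑ : {A : Set} → List A → (A → ℚ) → ℚ
  ∑ [] f = 0ℚ
  ∑ (x ∷ xs) f = f x + ∑ xs f

  ∑-cong : {A : Set} (xs : List A) {f g : A → ℚ} → (∀ x → f x ≡ g x) → ∑ xs f ≡ ∑ xs g
  ∑-cong [] eq = refl
  ∑-cong (x ∷ xs) eq = cong₂ _+_ (eq x) (∑-cong xs eq)

  ∑-++ : {A : Set} (xs ys : List A) (f : A → ℚ) → ∑ (xs ++ ys) f ≡ ∑ xs f + ∑ ys f
  ∑-++ [] ys f = sym (ℚP.+-identityˡ _)
  ∑-++ (x ∷ xs) ys f rewrite ∑-++ xs ys f = sym (ℚP.+-assoc (f x) _ _)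

  ∑-map : {A B : Set} (g : A → B) (xs : List A) (f : B → ℚ) → ∑ (map g xs) f ≡ ∑ xs (λ x → f (g x))
  ∑-map g [] f = refl
  ∑-map g (x ∷ xs) f = cong (f (g x) +_) (∑-map g xs f)

  ∑-concatMap : {A B : Set} (g : A → List B) (xs : List A) (f : B → ℚ) →
                ∑ (concatMap g xs) f ≡ ∑ xs (λ x → ∑ (g x) f)
  ∑-concatMap g [] f = refl
  ∑-concatMap g (x ∷ xs) f =
    trans (∑-++ (g x) (concatMap g xs) f) (cong (∑ (g x) f +_) (∑-concatMap g xs f))

  ∑-+ : {A : Set} (xs : List A) (f g : A → ℚ) → ∑ xs (λ x → f x + g x) ≡ ∑ xs f + ∑ xs g
  ∑-+ [] f g = refl
  ∑-+ (x ∷ xs) f g rewrite ∑-+ xs f g =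
    solve 4 (λ a b c d → (a :+ b) :+ (c :+ d) := (a :+ c) :+ (b :+ d)) refl (f x) (g x) (∑ xs f) (∑ xs g)

  ∑-*ˡ : {A : Set} (c : ℚ) (xs : List A) (f : A → ℚ) → ∑ xs (λ x → c * f x) ≡ c * ∑ xs f
  ∑-*ˡ c [] f = sym (ℚP.*-zeroʳ c)
  ∑-*ˡ c (x ∷ xs) f rewrite ∑-*ˡ c xs f = sym (ℚP.*-distribˡ-+ c (f x) _)

  ∑-*ʳ : {A : Set} (c : ℚ) (xs : List A) (f : A → ℚ) → ∑ xs (λ x → f x * c) ≡ ∑ xs f * c
  ∑-*ʳ c xs f = trans (∑-cong xs (λ x → ℚP.*-comm (f x) c)) (trans (∑-*ˡ c xs f) (ℚP.*-comm c _))

  ∑-zero : {A : Set} (xs : List A) → ∑ xs (λ _ → 0ℚ) ≡ 0ℚ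
  ∑-zero [] = refl
  ∑-zero (x ∷ xs) rewrite ∑-zero xs = refl

  ∑-vanish : {A : Set} (xs : List A) {f : A → ℚ} → (∀ x → f x ≡ 0ℚ) → ∑ xs f ≡ 0ℚ
  ∑-vanish xs f≡0 = trans (∑-cong xs f≡0) (∑-zero xs)

  ∑-neg : {A : Set} (xs : List A) (f : A → ℚ) → ∑ xs (λ x → - f x) ≡ - ∑ xs f
  ∑-neg [] f = refl
  ∑-neg (x ∷ xs) f rewrite ∑-neg xs f = sym (ℚP.neg-distrib-+ (f x) (∑ xs f))

  ∑-swap : {A B : Set} (xs : List A) (ys : List B) (f : A → B → ℚ) →
           ∑ xs (λ x → ∑ ys (f x)) ≡ ∑ ys (λ y → ∑ xs (λ x → f x y))
  ∑-swap [] ys f = sym (∑-zero ys)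
  ∑-swap (x ∷ xs) ys f rewrite ∑-swap xs ys f = sym (∑-+ ys (f x) (λ y → ∑ xs (λ x → f x y)))

  ∑-*-∑ : {A B : Set} (xs : List A) (ys : List B) (f : A → ℚ) (g : B → ℚ) →
          ∑ xs (λ x → ∑ ys (λ y → f x * g y)) ≡ ∑ xs f * ∑ ys g
  ∑-*-∑ xs ys f g = trans (∑-cong xs (λ x → ∑-*ˡ (f x) ys g)) (∑-*ʳ (∑ ys g) xs f)

  *-vanishʳ : ∀ a {b} → b ≡ 0ℚ → a * b ≡ 0ℚ
  *-vanishʳ a refl = ℚP.*-zeroʳ a

module SignsAndDeltas where

  sgn-+ : ∀ a b → sgn (a ℕ.+ b) ≡ sgn a * sgn b
  sgn-+ zero b = sym (ℚP.*-identityˡ _)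
  sgn-+ (suc a) b rewrite sgn-+ a b = ℚP.neg-distribˡ-* (sgn a) (sgn b)

  sgn-square : ∀ a → sgn a * sgn a ≡ 1ℚ
  sgn-square zero = refl
  sgn-square (suc a) = trans (solve 1 (λ x → (:- x) :* (:- x) := x :* x) refl (sgn a)) (sgn-square a)

  sgn-∸ : ∀ a b → b ≤ a → sgn (a ℕ.∸ b) ≡ sgn a * sgn b
  sgn-∸ a zero _ = sym (ℚP.*-identityʳ _)
  sgn-∸ (suc a) (suc b) (s≤s b≤a) rewrite sgn-∸ a b b≤a =
    solve 2 (λ x y → x :* y := (:- x) :* (:- y)) refl (sgn a) (sgn b)

  δ-refl : ∀ w → δ w w ≡ 1ℚ
  δ-refl w with w ≟c w
  ... | yes _ = refl
  ... | no w≢w = ⊥-elim (w≢w refl)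

  δ-≢ : ∀ {w u} → ¬ (w ≡ u) → δ w u ≡ 0ℚ
  δ-≢ {w} {u} w≢u with w ≟c u
  ... | yes w≡u = ⊥-elim (w≢u w≡u)
  ... | no _ = refl

  δ-sym : ∀ w u → δ w u ≡ δ u w
  δ-sym w u with w ≟c u
  ... | yes refl = sym (δ-refl w)
  ... | no w≢u = sym (δ-≢ (λ u≡w → w≢u (sym u≡w)))

  δ-size : ∀ u v → ¬ (size u ≡ size v) → δ u v ≡ 0ℚ
  δ-size u v size≢ = δ-≢ {u} {v} (λ u≡v → size≢ (cong size u≡v))

  δN : ℕ → ℕ → ℚ
  δN a b with a ℕ.≟ b
  ... | yes _ = 1ℚ
  ... | no _ = 0ℚ

  δN-refl : ∀ a → δN a a ≡ 1ℚ
  δN-refl a with a ℕ.≟ a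
  ... | yes _ = refl
  ... | no a≢a = ⊥-elim (a≢a refl)

  δN-≢ : ∀ {a b} → ¬ (a ≡ b) → δN a b ≡ 0ℚ
  δN-≢ {a} {b} a≢b with a ℕ.≟ b
  ... | yes a≡b = ⊥-elim (a≢b a≡b)
  ... | no _ = refl

  δN-suc : ∀ a b → δN (suc a) (suc b) ≡ δN a b
  δN-suc a b with suc a ℕ.≟ suc b | a ℕ.≟ b
  ... | yes _ | yes _ = refl
  ... | no _ | no _ = refl
  ... | yes 1+a≡1+b | no a≢b = ⊥-elim (a≢b (ℕP.suc-injective 1+a≡1+b))
  ... | no 1+a≢1+b | yes refl = ⊥-elim (1+a≢1+b refl)

  δN-+ˡ : ∀ i x y → δN (i ℕ.+ x) (i ℕ.+ y) ≡ δN x y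
  δN-+ˡ zero x y = refl
  δN-+ˡ (suc i) x y = trans (δN-suc (i ℕ.+ x) (i ℕ.+ y)) (δN-+ˡ i x y)

  δN-∸ : ∀ j s n → j ≤ n → δN (j ℕ.+ s) n ≡ δN s (n ℕ.∸ j)
  δN-∸ zero s n _ = refl
  δN-∸ (suc j) s (suc n) (s≤s j≤n) = trans (δN-suc (j ℕ.+ s) n) (δN-∸ j s n j≤n)

  δ-∷ : ∀ a u c v → δ (a ∷ u) (c ∷ v) ≡ δN a c * δ u v
  δ-∷ a u c v with (a ∷ u) ≟c (c ∷ v) | a ℕ.≟ c | u ≟c v
  ... | yes _ | yes _ | yes _ = refl
  ... | yes eq | no a≢c | _ = ⊥-elim (a≢c (proj₁ (∷-injective eq)))
  ... | yes eq | yes _ | no u≢v = ⊥-elim (u≢v (proj₂ (∷-injective eq)))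
  ... | no _ | yes _ | no _ = refl
  ... | no _ | no _ | yes _ = refl
  ... | no _ | no _ | no _ = refl
  ... | no ne | yes refl | yes refl = ⊥-elim (ne refl)

module LinearFunctionals where

  open Sums
  open SignsAndDeltas

  eval : (Comp → ℚ) → List (ℚ × Comp) → ℚ
  eval φ a = ∑ a (λ x → proj₁ x * φ (proj₂ x))

  coeff-∷ : ∀ w c u a → coeff w ((c , u) ∷ a) ≡ c * δ w u + coeff w a
  coeff-∷ w c u a with w ≟c u
  ... | yes _ = cong (_+ coeff w a) (sym (ℚP.*-identityʳ c))
  ... | no _ = sym (trans (cong (_+ coeff w a) (ℚP.*-zeroʳ c)) (ℚP.+-identityˡ _))

  coeff≡eval-δ : ∀ w a → coeff w a ≡ eval (δ w) a
  coeff≡eval-δ w [] = refl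
  coeff≡eval-δ w ((c , u) ∷ a) = trans (coeff-∷ w c u a) (cong (c * δ w u +_) (coeff≡eval-δ w a))

  eval-++ : ∀ φ a b → eval φ (a ++ b) ≡ eval φ a + eval φ b
  eval-++ φ a b = ∑-++ a b _

  eval-scaleN : ∀ φ c a → eval φ (scaleN c a) ≡ c * eval φ a
  eval-scaleN φ c a =
    trans (∑-map _ a _)
          (trans (∑-cong a (λ x → ℚP.*-assoc c (proj₁ x) (φ (proj₂ x)))) (∑-*ˡ c a _))

  coeff-++ : ∀ w a b → coeff w (a ++ b) ≡ coeff w a + coeff w b
  coeff-++ w a b rewrite coeff≡eval-δ w (a ++ b) | coeff≡eval-δ w a | coeff≡eval-δ w b = eval-++ (δ w) a b

  coeff-scaleN : ∀ w c a → coeff w (scaleN c a) ≡ c * coeff w a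
  coeff-scaleN w c a rewrite coeff≡eval-δ w (scaleN c a) | coeff≡eval-δ w a = eval-scaleN (δ w) c a

  remove : Comp → NSym → NSym
  remove u [] = []
  remove u ((c , v) ∷ a) with u ≟c v
  ... | yes _ = remove u a
  ... | no _ = (c , v) ∷ remove u a

  length-remove : ∀ u a → length (remove u a) ≤ length a
  length-remove u [] = z≤n
  length-remove u ((c , v) ∷ a) with u ≟c v
  ... | yes _ = ℕP.m≤n⇒m≤1+n (length-remove u a)
  ... | no _ = s≤s (length-remove u a)

  length-remove-∷ : ∀ u c a → length (remove u ((c , u) ∷ a)) < length ((c , u) ∷ a)
  length-remove-∷ u c a with u ≟c u
  ... | yes _ = s≤s (length-remove u a)
  ... | no u≢u = ⊥-elim (u≢u refl)

  eval-remove : ∀ φ u a → eval φ a ≡ coeff u a * φ u + eval φ (remove u a)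
  eval-remove φ u [] = sym (cong (_+ 0ℚ) (ℚP.*-zeroˡ (φ u)))
  eval-remove φ u ((c , v) ∷ a) with u ≟c v | eval-remove φ u a
  ... | yes refl | ih =
    trans (cong (c * φ u +_) ih)
          (solve 4 (λ c x f r → c :* f :+ (x :* f :+ r) := (c :+ x) :* f :+ r) refl
                 c (coeff u a) (φ u) (eval φ (remove u a)))
  ... | no _ | ih =
    trans (cong (c * φ v +_) ih)
          (solve 4 (λ g x f r → g :+ (x :* f :+ r) := x :* f :+ (g :+ r)) refl
                 (c * φ v) (coeff u a) (φ u) (eval φ (remove u a)))

  coeff-remove-self : ∀ u a → coeff u (remove u a) ≡ 0ℚ
  coeff-remove-self u [] = refl
  coeff-remove-self u ((c , v) ∷ a) with u ≟c v
  ... | yes _ = coeff-remove-self u a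
  ... | no u≢v =
    trans (coeff-∷ u c v (remove u a))
          (cong₂ _+_ (*-vanishʳ c (δ-≢ u≢v)) (coeff-remove-self u a))

  coeff-remove-other : ∀ u w a → ¬ (w ≡ u) → coeff w (remove u a) ≡ coeff w a
  coeff-remove-other u w [] w≢u = refl
  coeff-remove-other u w ((c , v) ∷ a) w≢u with u ≟c v
  ... | yes refl =
    trans (coeff-remove-other u w a w≢u)
          (sym (trans (coeff-∷ w c u a)
                      (trans (cong (_+ coeff w a) (*-vanishʳ c (δ-≢ w≢u))) (ℚP.+-identityˡ _))))
  ... | no _ =
    trans (coeff-∷ w c v (remove u a))
          (trans (cong (c * δ w v +_) (coeff-remove-other u w a w≢u)) (sym (coeff-∷ w c v a)))

  -- Remove all copies of one word at a time; the representative gets strictly shorter.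
  eval-coeff-zero : ∀ φ a → (∀ w → coeff w a ≡ 0ℚ) → eval φ a ≡ 0ℚ
  eval-coeff-zero φ a = go a (<-wellFounded (length a))
    where
    go : ∀ a → Acc ℕ._<_ (length a) → (∀ w → coeff w a ≡ 0ℚ) → eval φ a ≡ 0ℚ
    go [] _ _ = refl
    go ((c , u) ∷ a) (acc rec) coeff≡0 =
      trans (eval-remove φ u ((c , u) ∷ a))
            (trans (cong₂ _+_ (trans (cong (_* φ u) (coeff≡0 u)) (ℚP.*-zeroˡ (φ u)))
                              (go (remove u ((c , u) ∷ a)) (rec (length-remove-∷ u c a)) coeff-removed≡0))
                   (ℚP.+-identityˡ 0ℚ))
      where
      coeff-removed≡0 : ∀ w → coeff w (remove u ((c , u) ∷ a)) ≡ 0ℚ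
      coeff-removed≡0 w with w ≟c u
      ... | yes refl = coeff-remove-self w ((c , w) ∷ a)
      ... | no w≢u = trans (coeff-remove-other u w ((c , u) ∷ a) w≢u) (coeff≡0 w)

  eval-resp : ∀ φ {a b} → a ≈ b → eval φ a ≡ eval φ b
  eval-resp φ {a} {b} a≈b = begin
    eval φ a                                  ≡⟨ solve 2 (λ x y → x := (x :+ (:- con 1ℚ) :* y) :+ y) refl (eval φ a) (eval φ b) ⟩
    (eval φ a + - 1ℚ * eval φ b) + eval φ b   ≡⟨ cong (_+ eval φ b) difference≡0 ⟩
    0ℚ + eval φ b                             ≡⟨ ℚP.+-identityˡ _ ⟩
    eval φ b                                  ∎
    where
    open ≡-Reasoning
    a-b : NSym
    a-b = a ++ scaleN (- 1ℚ) b
    coeff≡0 : ∀ w → coeff w a-b ≡ 0ℚ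
    coeff≡0 w rewrite coeff-++ w a (scaleN (- 1ℚ) b) | coeff-scaleN w (- 1ℚ) b | a≈b w =
      solve 1 (λ x → x :+ (:- con 1ℚ) :* x := con 0ℚ) refl (coeff w b)
    difference≡0 : eval φ a + - 1ℚ * eval φ b ≡ 0ℚ
    difference≡0 = begin
      eval φ a + - 1ℚ * eval φ b               ≡⟨ cong (eval φ a +_) (eval-scaleN φ (- 1ℚ) b) ⟨
      eval φ a + eval φ (scaleN (- 1ℚ) b)      ≡⟨ eval-++ φ a (scaleN (- 1ℚ) b) ⟨
      eval φ a-b                               ≡⟨ eval-coeff-zero φ a-b coeff≡0 ⟩
      0ℚ                                       ∎

  eval-cong : ∀ {φ ψ} a → (∀ w → φ w ≡ ψ w) → eval φ a ≡ eval ψ a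
  eval-cong a φ≡ψ = ∑-cong a (λ x → cong (proj₁ x *_) (φ≡ψ (proj₂ x)))

  eval-+ : ∀ (f g : Comp → ℚ) a → eval (λ w → f w + g w) a ≡ eval f a + eval g a
  eval-+ f g a = trans (∑-cong a (λ x → ℚP.*-distribˡ-+ (proj₁ x) _ _)) (∑-+ a _ _)

  eval-*ˡ : ∀ k (f : Comp → ℚ) a → eval (λ w → k * f w) a ≡ k * eval f a
  eval-*ˡ k f a =
    trans (∑-cong a (λ x → solve 3 (λ c k y → c :* (k :* y) := k :* (c :* y)) refl (proj₁ x) k (f (proj₂ x))))
          (∑-*ˡ k a _)

  eval-eval-* : ∀ a b (f g : Comp → ℚ) → eval (λ u → eval (λ v → f u * g v) b) a ≡ eval f a * eval g b
  eval-eval-* a b f g =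
    trans (∑-cong a (λ x → trans (sym (∑-*ˡ (proj₁ x) b _)) (∑-cong b (λ y →
             solve 4 (λ c d u v → c :* (d :* (u :* v)) := (c :* u) :* (d :* v)) refl
                   (proj₁ x) (proj₁ y) (f (proj₂ x)) (g (proj₂ y))))))
          (∑-*-∑ a b (λ x → proj₁ x * f (proj₂ x)) (λ y → proj₁ y * g (proj₂ y)))

  eval-singleton : ∀ φ w → eval φ ((1ℚ , w) ∷ []) ≡ φ w
  eval-singleton φ w = trans (ℚP.+-identityʳ _) (ℚP.*-identityˡ _)

-- A cut vector z ∈ {true,false}ⁿ encodes a composition of n+1: true cuts between two parts.
-- Refinement of compositions becomes inclusion of the sets of cuts.
module CutVectors where

  open Sums

  comp′ : List Bool → ℕ × Comp
  comp′ [] = 0 , []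
  comp′ (true ∷ z) = 0 , (proj₁ (comp′ z) ∷ proj₂ (comp′ z))
  comp′ (false ∷ z) = suc (proj₁ (comp′ z)) , proj₂ (comp′ z)

  comp : List Bool → Comp
  comp z = proj₁ (comp′ z) ∷ proj₂ (comp′ z)

  noCuts : ℕ → List Bool
  noCuts a = replicate a false

  cuts : ℕ → Comp → List Bool
  cuts a [] = noCuts a
  cuts a (b ∷ β) = noCuts a ++ true ∷ cuts b β

  branch : List Bool → List (List Bool)
  branch x = (true ∷ x) ∷ (false ∷ x) ∷ []

  supersets : List Bool → List (List Bool)
  supersets [] = [] ∷ []
  supersets (true ∷ v) = map (true ∷_) (supersets v)
  supersets (false ∷ v) = concatMap branch (supersets v)

  subsets : List Bool → List (List Bool)
  subsets [] = [] ∷ []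
  subsets (true ∷ v) = concatMap branch (subsets v)
  subsets (false ∷ v) = map (false ∷_) (subsets v)

  vectors : ℕ → List (List Bool)
  vectors m = supersets (noCuts m)

  ∑-branch : ∀ xs (f : List Bool → ℚ) → ∑ (concatMap branch xs) f ≡ ∑ xs (λ x → f (true ∷ x) + f (false ∷ x))
  ∑-branch xs f =
    trans (∑-concatMap branch xs f) (∑-cong xs (λ x → cong (f (true ∷ x) +_) (ℚP.+-identityʳ (f (false ∷ x)))))

  concatMap-comp : (g : Comp → List Comp) → (∀ a α → g (a ∷ α) ≡ (0 ∷ a ∷ α) ∷ (suc a ∷ α) ∷ []) →
                   ∀ xs → concatMap g (map comp xs) ≡ map comp (concatMap branch xs)
  concatMap-comp g g-∷ [] = refl
  concatMap-comp g g-∷ (x ∷ xs) rewrite g-∷ (proj₁ (comp′ x)) (proj₂ (comp′ x)) =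
    cong (λ r → (0 ∷ comp x) ∷ (suc (proj₁ (comp′ x)) ∷ proj₂ (comp′ x)) ∷ r) (concatMap-comp g g-∷ xs)

  comps≡map-comp-vectors : ∀ m → comps (suc m) ≡ map comp (vectors m)
  comps≡map-comp-vectors zero = refl
  comps≡map-comp-vectors (suc m) =
    trans (cong (concatMap _) (comps≡map-comp-vectors m)) (concatMap-comp _ (λ _ _ → refl) (vectors m))

  comp′-noCuts-++ : ∀ a w → comp′ (noCuts a ++ w) ≡ (a ℕ.+ proj₁ (comp′ w) , proj₂ (comp′ w))
  comp′-noCuts-++ zero w = refl
  comp′-noCuts-++ (suc a) w rewrite comp′-noCuts-++ a w = refl

  comp′-noCuts : ∀ a → comp′ (noCuts a) ≡ (a , [])
  comp′-noCuts zero = refl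
  comp′-noCuts (suc a) rewrite comp′-noCuts a = refl

  comp′-cut-++ : ∀ x y → comp′ (x ++ true ∷ y) ≡ (proj₁ (comp′ x) , proj₂ (comp′ x) ++ comp y)
  comp′-cut-++ [] y = refl
  comp′-cut-++ (true ∷ x) y rewrite comp′-cut-++ x y = refl
  comp′-cut-++ (false ∷ x) y rewrite comp′-cut-++ x y = refl

  comp-cut-++ : ∀ x y → comp (x ++ true ∷ y) ≡ comp x ++ comp y
  comp-cut-++ x y rewrite comp′-cut-++ x y = refl

  comp-cuts : ∀ a α → comp (cuts a α) ≡ a ∷ α
  comp-cuts a [] rewrite comp′-noCuts a = refl
  comp-cuts a (b ∷ β) rewrite comp′-noCuts-++ a (true ∷ cuts b β) | ℕP.+-identityʳ a | comp-cuts b β = refl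

  cuts-comp : ∀ z → cuts (proj₁ (comp′ z)) (proj₂ (comp′ z)) ≡ z
  cuts-comp [] = refl
  cuts-comp (true ∷ z) = cong (true ∷_) (cuts-comp z)
  cuts-comp (false ∷ z) = trans (cuts-suc (proj₁ (comp′ z)) (proj₂ (comp′ z))) (cong (false ∷_) (cuts-comp z))
    where
    cuts-suc : ∀ a α → cuts (suc a) α ≡ false ∷ cuts a α
    cuts-suc a [] = refl
    cuts-suc a (b ∷ β) = refl

  comp-injective : ∀ {y x} → comp y ≡ comp x → y ≡ x
  comp-injective {y} {x} eq with ∷-injective eq
  ... | head≡ , tail≡ = trans (sym (cuts-comp y)) (trans (cong₂ cuts head≡ tail≡) (cuts-comp x))

  cuts-++ : ∀ a α b β → cuts a (α ++ b ∷ β) ≡ cuts a α ++ true ∷ cuts b β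
  cuts-++ a [] b β = refl
  cuts-++ a (c ∷ α) b β =
    trans (cong (λ z → noCuts a ++ true ∷ z) (cuts-++ c α b β))
          (sym (++-assoc (noCuts a) (true ∷ cuts c α) (true ∷ cuts b β)))

  ∑-supersets-++ : ∀ x y (f : List Bool → ℚ) →
                   ∑ (supersets (x ++ y)) f ≡ ∑ (supersets x) (λ x' → ∑ (supersets y) (λ y' → f (x' ++ y')))
  ∑-supersets-++ [] y f = sym (ℚP.+-identityʳ _)
  ∑-supersets-++ (true ∷ x) y f =
    trans (∑-map _ (supersets (x ++ y)) f) (trans (∑-supersets-++ x y _) (sym (∑-map _ (supersets x) _)))
  ∑-supersets-++ (false ∷ x) y f =
    trans (∑-branch (supersets (x ++ y)) f)
    (trans (∑-+ (supersets (x ++ y)) (λ z → f (true ∷ z)) (λ z → f (false ∷ z)))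
    (trans (cong₂ _+_ (∑-supersets-++ x y (λ z → f (true ∷ z))) (∑-supersets-++ x y (λ z → f (false ∷ z))))
    (trans (sym (∑-+ (supersets x) (λ x' → ∑ (supersets y) (λ y' → f (true ∷ x' ++ y')))
                                    (λ x' → ∑ (supersets y) (λ y' → f (false ∷ x' ++ y')))))
    (sym (∑-branch (supersets x) (λ x' → ∑ (supersets y) (λ y' → f (x' ++ y'))))))))

  ∑-subsets-++ : ∀ x y (f : List Bool → ℚ) →
                 ∑ (subsets (x ++ y)) f ≡ ∑ (subsets x) (λ x' → ∑ (subsets y) (λ y' → f (x' ++ y')))
  ∑-subsets-++ [] y f = sym (ℚP.+-identityʳ _)
  ∑-subsets-++ (false ∷ x) y f =
    trans (∑-map _ (subsets (x ++ y)) f) (trans (∑-subsets-++ x y _) (sym (∑-map _ (subsets x) _)))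
  ∑-subsets-++ (true ∷ x) y f =
    trans (∑-branch (subsets (x ++ y)) f)
    (trans (∑-+ (subsets (x ++ y)) (λ z → f (true ∷ z)) (λ z → f (false ∷ z)))
    (trans (cong₂ _+_ (∑-subsets-++ x y (λ z → f (true ∷ z))) (∑-subsets-++ x y (λ z → f (false ∷ z))))
    (trans (sym (∑-+ (subsets x) (λ x' → ∑ (subsets y) (λ y' → f (true ∷ x' ++ y')))
                                  (λ x' → ∑ (subsets y) (λ y' → f (false ∷ x' ++ y')))))
    (sym (∑-branch (subsets x) (λ x' → ∑ (subsets y) (λ y' → f (x' ++ y'))))))))

  ∑-subsets-noCuts : ∀ a (f : List Bool → ℚ) → ∑ (subsets (noCuts a)) f ≡ f (noCuts a)
  ∑-subsets-noCuts zero f = ℚP.+-identityʳ _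
  ∑-subsets-noCuts (suc a) f = trans (∑-map _ (subsets (noCuts a)) f) (∑-subsets-noCuts a _)

  ∑-refinements : ∀ a α (f : Comp → ℚ) → ∑ (refinements (a ∷ α)) f ≡ ∑ (supersets (cuts a α)) (λ z → f (comp z))
  ∑-refinements a [] f rewrite comps≡map-comp-vectors a =
    trans (∑-concatMap _ (map comp (vectors a)) f)
    (trans (∑-map comp (vectors a) _)
    (∑-cong (vectors a) (λ z → trans (ℚP.+-identityʳ _) (cong f (++-identityʳ (comp z))))))
  ∑-refinements a (b ∷ β) f rewrite comps≡map-comp-vectors a =
    trans (∑-concatMap _ (map comp (vectors a)) f)
    (trans (∑-map comp (vectors a) _)
    (trans (∑-cong (vectors a) (λ z →
             trans (∑-map _ (refinements (b ∷ β)) f)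
             (trans (∑-refinements b β _)
             (∑-cong (supersets (cuts b β)) (λ y → cong f (sym (comp-cut-++ z y)))))))
    (trans (∑-cong (vectors a) (λ z → sym (∑-map _ (supersets (cuts b β)) _)))
    (sym (∑-supersets-++ (noCuts a) (true ∷ cuts b β) _)))))

  ∑-coarsenings : ∀ a α (f : Comp → ℚ) → ∑ (coarsenings (a ∷ α)) f ≡ ∑ (subsets (cuts a α)) (λ z → f (comp z))
  ∑-coarsenings a [] f =
    trans (ℚP.+-identityʳ _) (sym (trans (∑-subsets-noCuts a _) (cong f (comp-cuts a []))))
  ∑-coarsenings a (b ∷ β) f =
    trans (∑-concatMap _ (coarsenings (b ∷ β)) f)
    (trans (∑-coarsenings b β _)
    (sym (trans (∑-subsets-++ (noCuts a) (true ∷ cuts b β) _)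
         (trans (∑-subsets-noCuts a _)
         (trans (∑-branch (subsets (cuts b β)) _)
         (∑-cong (subsets (cuts b β)) (λ z →
           cong₂ _+_ (cong f (cut z)) (trans (cong f (join z)) (sym (ℚP.+-identityʳ _))))))))))
    where
    cut : ∀ z → comp (noCuts a ++ true ∷ z) ≡ a ∷ comp z
    cut z rewrite comp′-noCuts-++ a (true ∷ z) | ℕP.+-identityʳ a = refl
    join : ∀ z → comp (noCuts a ++ false ∷ z) ≡ suc (a ℕ.+ proj₁ (comp′ z)) ∷ proj₂ (comp′ z)
    join z rewrite comp′-noCuts-++ a (false ∷ z) | ℕP.+-suc a (proj₁ (comp′ z)) = refl

  ∑-coarsenings-comp : ∀ y (f : Comp → ℚ) → ∑ (coarsenings (comp y)) f ≡ ∑ (subsets y) (λ w → f (comp w))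
  ∑-coarsenings-comp y f =
    trans (∑-coarsenings (proj₁ (comp′ y)) (proj₂ (comp′ y)) f) (cong (λ v → ∑ (subsets v) (λ w → f (comp w))) (cuts-comp y))

  ∑-refinements-comp : ∀ y (f : Comp → ℚ) → ∑ (refinements (comp y)) f ≡ ∑ (supersets y) (λ w → f (comp w))
  ∑-refinements-comp y f =
    trans (∑-refinements (proj₁ (comp′ y)) (proj₂ (comp′ y)) f) (cong (λ v → ∑ (supersets v) (λ w → f (comp w))) (cuts-comp y))

module CutSigns where

  open Sums
  open SignsAndDeltas
  open CutVectors

  ncut : List Bool → ℕ
  ncut [] = 0
  ncut (true ∷ z) = suc (ncut z)
  ncut (false ∷ z) = ncut z

  njoin : List Bool → ℕ
  njoin [] = 0
  njoin (true ∷ z) = njoin z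
  njoin (false ∷ z) = suc (njoin z)

  σ : List Bool → ℚ
  σ z = sgn (ncut z)

  τ : List Bool → ℚ
  τ z = sgn (njoin z)

  length-comp : ∀ z → length (comp z) ≡ suc (ncut z)
  length-comp [] = refl
  length-comp (true ∷ z) = cong suc (length-comp z)
  length-comp (false ∷ z) = length-comp z

  size-comp : ∀ z → size (comp z) ≡ suc (length z)
  size-comp [] = refl
  size-comp (true ∷ z) = cong suc (size-comp z)
  size-comp (false ∷ z) = cong suc (size-comp z)

  ncut+njoin : ∀ z → ncut z ℕ.+ njoin z ≡ length z
  ncut+njoin [] = refl
  ncut+njoin (true ∷ z) = cong suc (ncut+njoin z)
  ncut+njoin (false ∷ z) = trans (ℕP.+-suc (ncut z) (njoin z)) (cong suc (ncut+njoin z))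

  njoin-++ : ∀ y w → njoin (y ++ w) ≡ njoin y ℕ.+ njoin w
  njoin-++ [] w = refl
  njoin-++ (true ∷ y) w = njoin-++ y w
  njoin-++ (false ∷ y) w = cong suc (njoin-++ y w)

  τ-cut-++ : ∀ y z → τ (y ++ true ∷ z) ≡ τ y * τ z
  τ-cut-++ y z = trans (cong sgn (njoin-++ y (true ∷ z))) (sgn-+ (njoin y) (njoin z))

  sgn-njoin : ∀ y a → length y ≡ a → sgn (suc a ℕ.∸ length (comp y)) ≡ τ y
  sgn-njoin y a refl =
    trans (cong (λ k → sgn (suc (length y) ℕ.∸ k)) (length-comp y))
          (trans (cong (λ k → sgn (k ℕ.∸ ncut y)) (sym (ncut+njoin y))) (cong sgn (ℕP.m+n∸m≡n (ncut y) (njoin y))))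

  data _⊆_ : List Bool → List Bool → Set where
    [] : [] ⊆ []
    keep : ∀ {x y} → x ⊆ y → (true ∷ x) ⊆ (true ∷ y)
    add : ∀ {x y} → x ⊆ y → (false ∷ x) ⊆ (true ∷ y)
    skip : ∀ {x y} → x ⊆ y → (false ∷ x) ⊆ (false ∷ y)

  ⊆-length : ∀ {x y} → x ⊆ y → length x ≡ length y
  ⊆-length [] = refl
  ⊆-length (keep x⊆y) = cong suc (⊆-length x⊆y)
  ⊆-length (add x⊆y) = cong suc (⊆-length x⊆y)
  ⊆-length (skip x⊆y) = cong suc (⊆-length x⊆y)

  ⊆-ncut : ∀ {x y} → x ⊆ y → ncut x ≤ ncut y
  ⊆-ncut [] = z≤n
  ⊆-ncut (keep x⊆y) = s≤s (⊆-ncut x⊆y)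
  ⊆-ncut (add x⊆y) = ℕP.m≤n⇒m≤1+n (⊆-ncut x⊆y)
  ⊆-ncut (skip x⊆y) = ⊆-ncut x⊆y

  sgn-length-∸ : ∀ {w y} → w ⊆ y → sgn (length (comp y) ℕ.∸ length (comp w)) ≡ σ y * σ w
  sgn-length-∸ {w} {y} w⊆y =
    trans (cong₂ (λ a b → sgn (a ℕ.∸ b)) (length-comp y) (length-comp w)) (sgn-∸ (ncut y) (ncut w) (⊆-ncut w⊆y))

  ∑-supersets-cong : ∀ x {f g : List Bool → ℚ} → (∀ y → x ⊆ y → f y ≡ g y) → ∑ (supersets x) f ≡ ∑ (supersets x) g
  ∑-supersets-cong [] eq = cong (_+ 0ℚ) (eq [] [])
  ∑-supersets-cong (true ∷ x) {f} {g} eq =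
    trans (∑-map _ (supersets x) f)
          (trans (∑-supersets-cong x (λ y x⊆y → eq _ (keep x⊆y))) (sym (∑-map _ (supersets x) g)))
  ∑-supersets-cong (false ∷ x) {f} {g} eq =
    trans (∑-branch (supersets x) f)
          (trans (∑-supersets-cong x (λ y x⊆y → cong₂ _+_ (eq _ (add x⊆y)) (eq _ (skip x⊆y))))
                 (sym (∑-branch (supersets x) g)))

  ∑-subsets-cong : ∀ x {f g : List Bool → ℚ} → (∀ y → y ⊆ x → f y ≡ g y) → ∑ (subsets x) f ≡ ∑ (subsets x) g
  ∑-subsets-cong [] eq = cong (_+ 0ℚ) (eq [] [])
  ∑-subsets-cong (false ∷ x) {f} {g} eq =
    trans (∑-map _ (subsets x) f)
          (trans (∑-subsets-cong x (λ y y⊆x → eq _ (skip y⊆x))) (sym (∑-map _ (subsets x) g)))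
  ∑-subsets-cong (true ∷ x) {f} {g} eq =
    trans (∑-branch (subsets x) f)
          (trans (∑-subsets-cong x (λ y y⊆x → cong₂ _+_ (eq _ (keep y⊆x)) (eq _ (add y⊆x))))
                 (sym (∑-branch (subsets x) g)))

  ∑-vectors-cong : ∀ m {f g : List Bool → ℚ} → (∀ y → length y ≡ m → f y ≡ g y) → ∑ (vectors m) f ≡ ∑ (vectors m) g
  ∑-vectors-cong m eq =
    ∑-supersets-cong (noCuts m) (λ y m⊆y → eq y (trans (sym (⊆-length m⊆y)) (length-replicate m)))

  δv : List Bool → List Bool → ℚ
  δv [] [] = 1ℚ
  δv (true ∷ y) (true ∷ x) = δv y x
  δv (false ∷ y) (false ∷ x) = δv y x
  δv _ _ = 0ℚ

  δv-refl : ∀ x → δv x x ≡ 1ℚ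
  δv-refl [] = refl
  δv-refl (true ∷ x) = δv-refl x
  δv-refl (false ∷ x) = δv-refl x

  δv-≢ : ∀ {y x} → ¬ (y ≡ x) → δv y x ≡ 0ℚ
  δv-≢ {[]} {[]} y≢x = ⊥-elim (y≢x refl)
  δv-≢ {true ∷ y} {true ∷ x} y≢x = δv-≢ (λ y≡x → y≢x (cong (true ∷_) y≡x))
  δv-≢ {false ∷ y} {false ∷ x} y≢x = δv-≢ (λ y≡x → y≢x (cong (false ∷_) y≡x))
  δv-≢ {[]} {_ ∷ _} _ = refl
  δv-≢ {true ∷ _} {[]} _ = refl
  δv-≢ {true ∷ _} {false ∷ _} _ = refl
  δv-≢ {false ∷ _} {[]} _ = refl
  δv-≢ {false ∷ _} {true ∷ _} _ = refl

  δ-comp : ∀ y x → δ (comp y) (comp x) ≡ δv y x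
  δ-comp y x with ≡-dec 𝔹P._≟_ y x
  ... | yes refl = trans (δ-refl (comp y)) (sym (δv-refl y))
  ... | no y≢x = trans (δ-≢ {comp y} {comp x} (λ eq → y≢x (comp-injective eq))) (sym (δv-≢ y≢x))

  ∑-vectors-δv : ∀ m x (f : List Bool → ℚ) → ∑ (vectors m) (λ y → δv y x * f y) ≡ δN (length x) m * f x
  ∑-vectors-δv zero [] f = ℚP.+-identityʳ _
  ∑-vectors-δv zero (b ∷ x) f = trans (ℚP.+-identityʳ _) (trans (ℚP.*-zeroˡ (f [])) (sym (ℚP.*-zeroˡ (f (b ∷ x)))))
  ∑-vectors-δv (suc m) [] f =
    trans (∑-branch (vectors m) _)
          (trans (∑-vanish (vectors m) (λ y → cong₂ _+_ (ℚP.*-zeroˡ (f (true ∷ y))) (ℚP.*-zeroˡ (f (false ∷ y)))))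
                 (sym (ℚP.*-zeroˡ (f []))))
  ∑-vectors-δv (suc m) (true ∷ x) f =
    trans (∑-branch (vectors m) _)
          (trans (∑-cong (vectors m) (λ y → trans (cong (δv y x * f (true ∷ y) +_) (ℚP.*-zeroˡ (f (false ∷ y))))
                                                  (ℚP.+-identityʳ _)))
                 (trans (∑-vectors-δv m x (λ y → f (true ∷ y))) (cong (_* f (true ∷ x)) (sym (δN-suc (length x) m)))))
  ∑-vectors-δv (suc m) (false ∷ x) f =
    trans (∑-branch (vectors m) _)
          (trans (∑-cong (vectors m) (λ y → trans (cong (_+ δv y x * f (false ∷ y)) (ℚP.*-zeroˡ (f (true ∷ y))))
                                                  (ℚP.+-identityˡ _)))
                 (trans (∑-vectors-δv m x (λ y → f (false ∷ y))) (cong (_* f (false ∷ x)) (sym (δN-suc (length x) m)))))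

module Möbius where

  open Sums
  open CutVectors
  open CutSigns

  möbius-subsets : ∀ x (X : List Bool → ℚ) → ∑ (subsets x) (λ y → ∑ (subsets y) (λ w → σ y * σ w * X w)) ≡ X x
  möbius-subsets [] X = solve 1 (λ a → (con 1ℚ :* con 1ℚ :* a :+ con 0ℚ) :+ con 0ℚ := a) refl (X [])
  möbius-subsets (false ∷ x) X =
    trans (∑-map _ (subsets x) _)
          (trans (∑-cong (subsets x) (λ y → ∑-map _ (subsets y) _)) (möbius-subsets x (λ w → X (false ∷ w))))
  möbius-subsets (true ∷ x) X =
    trans (∑-branch (subsets x) _) (trans (∑-cong (subsets x) cut-or-join) (möbius-subsets x (λ w → X (true ∷ w))))
    where
    cut-or-join : ∀ y → ∑ (subsets (true ∷ y)) (λ w → σ (true ∷ y) * σ w * X w)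
                        + ∑ (subsets (false ∷ y)) (λ w → σ (false ∷ y) * σ w * X w)
                      ≡ ∑ (subsets y) (λ w → σ y * σ w * X (true ∷ w))
    cut-or-join y =
      trans (cong₂ _+_ (∑-branch (subsets y) _) (∑-map (false ∷_) (subsets y) _))
      (trans (sym (∑-+ (subsets y) _ _))
      (∑-cong (subsets y) (λ w →
        solve 4 (λ a b p q → (:- a) :* (:- b) :* p :+ (:- a) :* b :* q :+ a :* b :* q := a :* b :* p) refl
              (σ y) (σ w) (X (true ∷ w)) (X (false ∷ w)))))

  möbius-supersets : ∀ x (Y : List Bool → ℚ) → ∑ (supersets x) (λ y → σ y * σ x * ∑ (supersets y) Y) ≡ Y x
  möbius-supersets [] Y = solve 1 (λ a → con 1ℚ :* con 1ℚ :* (a :+ con 0ℚ) :+ con 0ℚ := a) refl (Y [])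
  möbius-supersets (true ∷ x) Y =
    trans (∑-map _ (supersets x) _) (trans (∑-cong (supersets x) cut) (möbius-supersets x (λ z → Y (true ∷ z))))
    where
    cut : ∀ y → σ (true ∷ y) * σ (true ∷ x) * ∑ (supersets (true ∷ y)) Y ≡ σ y * σ x * ∑ (supersets y) (λ z → Y (true ∷ z))
    cut y =
      trans (cong (σ (true ∷ y) * σ (true ∷ x) *_) (∑-map _ (supersets y) Y))
            (solve 3 (λ a b s → (:- a) :* (:- b) :* s := a :* b :* s) refl (σ y) (σ x) _)
  möbius-supersets (false ∷ x) Y =
    trans (∑-branch (supersets x) _) (trans (∑-cong (supersets x) cut-or-join) (möbius-supersets x (λ z → Y (false ∷ z))))
    where
    cut-or-join : ∀ y → σ (true ∷ y) * σ (false ∷ x) * ∑ (supersets (true ∷ y)) Y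
                        + σ (false ∷ y) * σ (false ∷ x) * ∑ (supersets (false ∷ y)) Y
                      ≡ σ y * σ x * ∑ (supersets y) (λ z → Y (false ∷ z))
    cut-or-join y =
      trans (cong₂ (λ u v → σ (true ∷ y) * σ (false ∷ x) * u + σ (false ∷ y) * σ (false ∷ x) * v)
                   (∑-map _ (supersets y) Y)
                   (trans (∑-branch (supersets y) Y) (∑-+ (supersets y) _ _)))
            (solve 4 (λ a b s t → (:- a) :* b :* s :+ a :* b :* (s :+ t) := a :* b :* t) refl (σ y) (σ x) _ _)

  τ-transform-involutive : ∀ x (X : List Bool → ℚ) →
                           ∑ (supersets x) (λ y → τ y * ∑ (supersets y) (λ z → τ z * X z)) ≡ X x
  τ-transform-involutive [] X = solve 1 (λ a → con 1ℚ :* (con 1ℚ :* a :+ con 0ℚ) :+ con 0ℚ := a) refl (X [])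
  τ-transform-involutive (true ∷ x) X =
    trans (∑-map _ (supersets x) _)
          (trans (∑-cong (supersets x) (λ y → cong (τ y *_) (∑-map _ (supersets y) _)))
                 (τ-transform-involutive x (λ z → X (true ∷ z))))
  τ-transform-involutive (false ∷ x) X =
    trans (∑-branch (supersets x) _) (trans (∑-cong (supersets x) cut-or-join) (τ-transform-involutive x (λ z → X (false ∷ z))))
    where
    cut-or-join : ∀ y → τ (true ∷ y) * ∑ (supersets (true ∷ y)) (λ z → τ z * X z)
                        + τ (false ∷ y) * ∑ (supersets (false ∷ y)) (λ z → τ z * X z)
                      ≡ τ y * ∑ (supersets y) (λ z → τ z * X (false ∷ z))
    cut-or-join y =
      trans (cong₂ (λ u v → τ y * u + (- τ y) * v)
                   (∑-map _ (supersets y) _)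
                   (trans (∑-branch (supersets y) _) (∑-+ (supersets y) _ _)))
      (trans (cong (λ u → τ y * ∑ (supersets y) (λ z → τ z * X (true ∷ z)) + (- τ y) * (∑ (supersets y) (λ z → τ z * X (true ∷ z)) + u))
                   (trans (∑-cong (supersets y) (λ z → sym (ℚP.neg-distribˡ-* (τ z) (X (false ∷ z)))))
                          (∑-neg (supersets y) _)))
             (solve 3 (λ a s t → a :* s :+ (:- a) :* (s :+ (:- t)) := a :* t) refl (τ y) _ _))

  ∑-subsets-δv-[] : ∀ b x → ∑ (subsets (b ∷ x)) (λ w → δv w []) ≡ 0ℚ
  ∑-subsets-δv-[] b x = trans (∑-subsets-cong (b ∷ x) {g = λ _ → 0ℚ} nonempty) (∑-zero (subsets (b ∷ x)))
    where
    nonempty : ∀ y → y ⊆ (b ∷ x) → δv y [] ≡ 0ℚ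
    nonempty _ (keep _) = refl
    nonempty _ (add _) = refl
    nonempty _ (skip _) = refl

  ∑-subsets-true-δv : ∀ b y x → ∑ (subsets (true ∷ x)) (λ w → δv w (b ∷ y)) ≡ ∑ (subsets x) (λ w → δv w y)
  ∑-subsets-true-δv true y x = trans (∑-branch (subsets x) _) (∑-cong (subsets x) (λ w → ℚP.+-identityʳ _))
  ∑-subsets-true-δv false y x = trans (∑-branch (subsets x) _) (∑-cong (subsets x) (λ w → ℚP.+-identityˡ _))

  ∑-subsets-false-δv-true : ∀ y x → ∑ (subsets (false ∷ x)) (λ w → δv w (true ∷ y)) ≡ 0ℚ
  ∑-subsets-false-δv-true y x = trans (∑-map _ (subsets x) _) (∑-zero (subsets x))

  möbius-inclusion : ∀ c x → ∑ (supersets c) (λ y → σ y * σ c * ∑ (subsets x) (λ w → δv w y)) ≡ δv x c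
  möbius-inclusion [] [] = refl
  möbius-inclusion [] (b ∷ x) = trans (cong (λ u → 1ℚ * 1ℚ * u + 0ℚ) (∑-subsets-δv-[] b x)) (sym (δv-≢ {b ∷ x} {[]} λ ()))
  möbius-inclusion (b ∷ c) [] = trans (∑-supersets-cong (b ∷ c) {g = λ _ → 0ℚ} nonempty) (∑-zero (supersets (b ∷ c)))
    where
    nonempty : ∀ y → (b ∷ c) ⊆ y → σ y * σ (b ∷ c) * (δv [] y + 0ℚ) ≡ 0ℚ
    nonempty y (keep _) = *-vanishʳ (σ y * σ (b ∷ c)) refl
    nonempty y (add _) = *-vanishʳ (σ y * σ (b ∷ c)) refl
    nonempty y (skip _) = *-vanishʳ (σ y * σ (b ∷ c)) refl
  möbius-inclusion (true ∷ c) (true ∷ x) =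
    trans (∑-map _ (supersets c) _) (trans (∑-cong (supersets c) cut) (möbius-inclusion c x))
    where
    cut : ∀ y → σ (true ∷ y) * σ (true ∷ c) * ∑ (subsets (true ∷ x)) (λ w → δv w (true ∷ y)) ≡ σ y * σ c * ∑ (subsets x) (λ w → δv w y)
    cut y = trans (cong (σ (true ∷ y) * σ (true ∷ c) *_) (∑-subsets-true-δv true y x))
                  (solve 3 (λ a b s → (:- a) :* (:- b) :* s := a :* b :* s) refl (σ y) (σ c) _)
  möbius-inclusion (true ∷ c) (false ∷ x) =
    trans (∑-map _ (supersets c) _)
          (∑-vanish (supersets c) (λ y → *-vanishʳ (σ (true ∷ y) * σ (true ∷ c)) (∑-subsets-false-δv-true y x)))
  möbius-inclusion (false ∷ c) (true ∷ x) =
    trans (∑-branch (supersets c) _) (∑-vanish (supersets c) cut-or-join)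
    where
    cut-or-join : ∀ y → σ (true ∷ y) * σ (false ∷ c) * ∑ (subsets (true ∷ x)) (λ w → δv w (true ∷ y))
                        + σ (false ∷ y) * σ (false ∷ c) * ∑ (subsets (true ∷ x)) (λ w → δv w (false ∷ y)) ≡ 0ℚ
    cut-or-join y =
      trans (cong₂ (λ u v → σ (true ∷ y) * σ (false ∷ c) * u + σ (false ∷ y) * σ (false ∷ c) * v)
                   (∑-subsets-true-δv true y x) (∑-subsets-true-δv false y x))
            (solve 3 (λ a b s → (:- a) :* b :* s :+ a :* b :* s := con 0ℚ) refl (σ y) (σ c) _)
  möbius-inclusion (false ∷ c) (false ∷ x) =
    trans (∑-branch (supersets c) _) (trans (∑-cong (supersets c) cut-or-join) (möbius-inclusion c x))
    where
    cut-or-join : ∀ y → σ (true ∷ y) * σ (false ∷ c) * ∑ (subsets (false ∷ x)) (λ w → δv w (true ∷ y))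
                        + σ (false ∷ y) * σ (false ∷ c) * ∑ (subsets (false ∷ x)) (λ w → δv w (false ∷ y))
                      ≡ σ y * σ c * ∑ (subsets x) (λ w → δv w y)
    cut-or-join y =
      trans (cong₂ (λ u v → σ (true ∷ y) * σ (false ∷ c) * u + σ (false ∷ y) * σ (false ∷ c) * v)
                   (∑-subsets-false-δv-true y x) (∑-map _ (subsets x) _))
            (solve 3 (λ a b s → (:- a) :* b :* con 0ℚ :+ a :* b :* s := a :* b :* s) refl (σ y) (σ c) _)

  τ-up : List Bool → List Bool → ℚ
  τ-up x c = ∑ (supersets x) (λ y → τ y * δv y c)

  τ-up-true-true : ∀ x c → τ-up (true ∷ x) (true ∷ c) ≡ τ-up x c
  τ-up-true-true x c = ∑-map _ (supersets x) _

  τ-up-true-false : ∀ x c → τ-up (true ∷ x) (false ∷ c) ≡ 0ℚ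
  τ-up-true-false x c = trans (∑-map _ (supersets x) _) (∑-vanish (supersets x) (λ y → ℚP.*-zeroʳ (τ y)))

  τ-up-false-true : ∀ x c → τ-up (false ∷ x) (true ∷ c) ≡ τ-up x c
  τ-up-false-true x c =
    trans (∑-branch (supersets x) _)
          (∑-cong (supersets x) (λ y → trans (cong (τ y * δv y c +_) (ℚP.*-zeroʳ (- τ y))) (ℚP.+-identityʳ _)))

  τ-up-false-false : ∀ x c → τ-up (false ∷ x) (false ∷ c) ≡ - τ-up x c
  τ-up-false-false x c =
    trans (∑-branch (supersets x) _)
          (trans (∑-cong (supersets x) (λ y → trans (cong (_+ (- τ y) * δv y c) (ℚP.*-zeroʳ (τ y)))
                                                   (trans (ℚP.+-identityˡ _) (sym (ℚP.neg-distribˡ-* (τ y) (δv y c))))))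
                 (∑-neg (supersets x) _))

  -- τ-up x c = [x ⊆ c] τ c, and this matrix is inverted by the signed lower-incidence matrix.
  τ-up-inverse : ∀ w x → ∑ (subsets w) (λ c → τ c * σ c * σ w * τ-up x c) ≡ δv x w
  τ-up-inverse [] [] = refl
  τ-up-inverse [] (b ∷ x) =
    trans (cong (λ u → 1ℚ * 1ℚ * 1ℚ * u + 0ℚ) (trans (∑-supersets-cong (b ∷ x) {g = λ _ → 0ℚ} nonempty) (∑-zero (supersets (b ∷ x)))))
          (sym (δv-≢ {b ∷ x} {[]} λ ()))
    where
    nonempty : ∀ y → (b ∷ x) ⊆ y → τ y * δv y [] ≡ 0ℚ
    nonempty y (keep _) = ℚP.*-zeroʳ (τ y)
    nonempty y (add _) = ℚP.*-zeroʳ (τ y)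
    nonempty y (skip _) = ℚP.*-zeroʳ (τ y)
  τ-up-inverse (b ∷ w) [] = trans (∑-subsets-cong (b ∷ w) {g = λ _ → 0ℚ} nonempty) (∑-zero (subsets (b ∷ w)))
    where
    nonempty : ∀ c → c ⊆ (b ∷ w) → τ c * σ c * σ (b ∷ w) * τ-up [] c ≡ 0ℚ
    nonempty c (keep _) = *-vanishʳ (τ c * σ c * σ (b ∷ w)) refl
    nonempty c (add _) = *-vanishʳ (τ c * σ c * σ (b ∷ w)) refl
    nonempty c (skip _) = *-vanishʳ (τ c * σ c * σ (b ∷ w)) refl
  τ-up-inverse (true ∷ w) (true ∷ x) =
    trans (∑-branch (subsets w) _) (trans (∑-cong (subsets w) cut-or-join) (τ-up-inverse w x))
    where
    cut-or-join : ∀ c → τ (true ∷ c) * σ (true ∷ c) * σ (true ∷ w) * τ-up (true ∷ x) (true ∷ c)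
                        + τ (false ∷ c) * σ (false ∷ c) * σ (true ∷ w) * τ-up (true ∷ x) (false ∷ c)
                      ≡ τ c * σ c * σ w * τ-up x c
    cut-or-join c =
      trans (cong₂ (λ u v → τ c * (- σ c) * (- σ w) * u + (- τ c) * σ c * (- σ w) * v) (τ-up-true-true x c) (τ-up-true-false x c))
            (solve 4 (λ a b d s → a :* (:- b) :* (:- d) :* s :+ (:- a) :* b :* (:- d) :* con 0ℚ := a :* b :* d :* s) refl
                   (τ c) (σ c) (σ w) (τ-up x c))
  τ-up-inverse (true ∷ w) (false ∷ x) = trans (∑-branch (subsets w) _) (∑-vanish (subsets w) cut-or-join)
    where
    cut-or-join : ∀ c → τ (true ∷ c) * σ (true ∷ c) * σ (true ∷ w) * τ-up (false ∷ x) (true ∷ c)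
                        + τ (false ∷ c) * σ (false ∷ c) * σ (true ∷ w) * τ-up (false ∷ x) (false ∷ c) ≡ 0ℚ
    cut-or-join c =
      trans (cong₂ (λ u v → τ c * (- σ c) * (- σ w) * u + (- τ c) * σ c * (- σ w) * v) (τ-up-false-true x c) (τ-up-false-false x c))
            (solve 4 (λ a b d s → a :* (:- b) :* (:- d) :* s :+ (:- a) :* b :* (:- d) :* (:- s) := con 0ℚ) refl
                   (τ c) (σ c) (σ w) (τ-up x c))
  τ-up-inverse (false ∷ w) (true ∷ x) =
    trans (∑-map _ (subsets w) _)
          (∑-vanish (subsets w) (λ c → *-vanishʳ (τ (false ∷ c) * σ (false ∷ c) * σ (false ∷ w)) (τ-up-true-false x c)))
  τ-up-inverse (false ∷ w) (false ∷ x) =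
    trans (∑-map _ (subsets w) _)
          (trans (∑-cong (subsets w) (λ c →
                   trans (cong (τ (false ∷ c) * σ (false ∷ c) * σ (false ∷ w) *_) (τ-up-false-false x c))
                         (solve 4 (λ a b d s → (:- a) :* b :* d :* (:- s) := a :* b :* d :* s) refl (τ c) (σ c) (σ w) (τ-up x c))))
                 (τ-up-inverse w x))

module NSymAlgebra where

  open Sums
  open LinearFunctionals

  ≈-setoid : Setoid 0ℓ 0ℓ
  ≈-setoid = record
    { Carrier = NSym
    ; _≈_ = _≈_
    ; isEquivalence = record
      { refl = λ _ → refl
      ; sym = λ a≈b w → sym (a≈b w)
      ; trans = λ a≈b b≈c w → trans (a≈b w) (b≈c w)
      }
    }

  word : Comp → NSym
  word w = (1ℚ , w) ∷ []

  M : Comp → QSym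
  M γ = (1ℚ , γ) ∷ []

  eval-*N : ∀ φ a b → eval φ (a *N b) ≡ eval (λ u → eval (λ v → φ (u ++ v)) b) a
  eval-*N φ [] b = refl
  eval-*N φ ((c , u) ∷ a) b =
    trans (eval-++ φ (map (λ x → (c * proj₁ x , u ++ proj₂ x)) b) (a *N b))
          (cong₂ _+_ (trans (∑-map _ b _) (trans (∑-cong b (λ x → ℚP.*-assoc c (proj₁ x) _)) (∑-*ˡ c b _)))
                     (eval-*N φ a b))

  coeff-*N : ∀ w a b → coeff w (a *N b) ≡ eval (λ u → eval (λ v → δ w (u ++ v)) b) a
  coeff-*N w a b = trans (coeff≡eval-δ w (a *N b)) (eval-*N (δ w) a b)

  *N-cong : ∀ {a a' b b'} → a ≈ a' → b ≈ b' → a *N b ≈ a' *N b'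
  *N-cong {a} {a'} {b} {b'} a≈a' b≈b' w =
    trans (coeff-*N w a b)
    (trans (eval-resp (λ u → eval (λ v → δ w (u ++ v)) b) {a} {a'} a≈a')
    (trans (eval-cong a' (λ u → eval-resp (λ v → δ w (u ++ v)) {b} {b'} b≈b'))
           (sym (coeff-*N w a' b'))))

  +N-cong : ∀ {a a' b b'} → a ≈ a' → b ≈ b' → a +N b ≈ a' +N b'
  +N-cong {a} {a'} {b} {b'} a≈a' b≈b' w =
    trans (coeff-++ w a b) (trans (cong₂ _+_ (a≈a' w) (b≈b' w)) (sym (coeff-++ w a' b')))

  scaleN-cong : ∀ c {a a'} → a ≈ a' → scaleN c a ≈ scaleN c a'
  scaleN-cong c {a} {a'} a≈a' w =
    trans (coeff-scaleN w c a) (trans (cong (c *_) (a≈a' w)) (sym (coeff-scaleN w c a')))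

  sumN-cong : ∀ {A : Set} (xs : List A) {f g : A → NSym} → (∀ x → f x ≈ g x) → sumN (map f xs) ≈ sumN (map g xs)
  sumN-cong [] f≈g = λ _ → refl
  sumN-cong (x ∷ xs) {f} {g} f≈g = +N-cong {f x} {g x} (f≈g x) (sumN-cong xs f≈g)

  *N-identityʳ : ∀ a → a *N oneN ≈ a
  *N-identityʳ a w =
    trans (coeff-*N w a oneN)
          (trans (eval-cong a (λ u → trans (eval-singleton (λ v → δ w (u ++ v)) []) (cong (δ w) (++-identityʳ u))))
                 (sym (coeff≡eval-δ w a)))

  *N-zeroʳ : ∀ a → a *N zeroN ≈ zeroN
  *N-zeroʳ a w = trans (coeff-*N w a zeroN) (∑-vanish a (λ x → ℚP.*-zeroʳ (proj₁ x)))

  scaleN-*N-zeroʳ : ∀ c a {b} → b ≈ zeroN → scaleN c (a *N b) ≈ zeroN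
  scaleN-*N-zeroʳ c a {b} b≈0 w =
    trans (coeff-scaleN w c (a *N b)) (*-vanishʳ c (trans (*N-cong {a} {a} {b} {zeroN} (λ _ → refl) b≈0 w) (*N-zeroʳ a w)))

  pairing≡eval : ∀ p a g → pairing p a g ≡ eval (λ w → eval (p w) g) a
  pairing≡eval p [] g = refl
  pairing≡eval p ((c , w) ∷ a) g = cong₂ _+_ (inner g) (pairing≡eval p a g)
    where
    inner : ∀ g → foldr (λ x acc → c * proj₁ x * p w (proj₂ x) + acc) 0ℚ g ≡ c * eval (p w) g
    inner [] = sym (ℚP.*-zeroʳ c)
    inner ((d , γ) ∷ g) rewrite inner g =
      solve 4 (λ c d q s → c :* d :* q :+ c :* s := c :* (d :* q :+ s)) refl c d (p w γ) (eval (p w) g)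

  pairing≡evalᴿ : ∀ p a g → pairing p a g ≡ eval (λ γ → eval (λ w → p w γ) a) g
  pairing≡evalᴿ p a g =
    trans (pairing≡eval p a g)
    (trans (∑-cong a (λ x → sym (∑-*ˡ (proj₁ x) g _)))
    (trans (∑-swap a g _)
    (∑-cong g (λ y → trans (∑-cong a (λ x → solve 3 (λ c d q → c :* (d :* q) := d :* (c :* q)) refl (proj₁ x) (proj₁ y) _))
                            (∑-*ˡ (proj₁ y) a _)))))

  pairing-respˡ : ∀ p {a a'} g → a ≈ a' → pairing p a g ≡ pairing p a' g
  pairing-respˡ p {a} {a'} g a≈a' =
    trans (pairing≡eval p a g) (trans (eval-resp (λ w → eval (p w) g) {a} {a'} a≈a') (sym (pairing≡eval p a' g)))

  pairing-M : ∀ p a γ → pairing p a (M γ) ≡ eval (λ w → p w γ) a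
  pairing-M p a γ = trans (pairing≡eval p a (M γ)) (eval-cong a (λ w → eval-singleton (p w) γ))

  pairing-expand-M : ∀ p a g → pairing p a g ≡ eval (λ γ → pairing p a (M γ)) g
  pairing-expand-M p a g = trans (pairing≡evalᴿ p a g) (eval-cong g (λ γ → sym (pairing-M p a γ)))

  pairing-++ˡ : ∀ p a b g → pairing p (a ++ b) g ≡ pairing p a g + pairing p b g
  pairing-++ˡ p a b g =
    trans (pairing≡eval p (a ++ b) g)
          (trans (eval-++ _ a b) (cong₂ _+_ (sym (pairing≡eval p a g)) (sym (pairing≡eval p b g))))

  pairing-scaleNˡ : ∀ p k a g → pairing p (scaleN k a) g ≡ k * pairing p a g
  pairing-scaleNˡ p k a g =
    trans (pairing≡eval p (scaleN k a) g) (trans (eval-scaleN _ k a) (cong (k *_) (sym (pairing≡eval p a g))))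

  pairing-sumNˡ : ∀ p xs g → pairing p (sumN xs) g ≡ ∑ xs (λ a → pairing p a g)
  pairing-sumNˡ p [] g = refl
  pairing-sumNˡ p (x ∷ xs) g = trans (pairing-++ˡ p x (sumN xs) g) (cong (pairing p x g +_) (pairing-sumNˡ p xs g))

  sumN-scaled-words : ∀ (βs : List Comp) (s : Comp → ℚ) → sumN (map (λ β → scaleN (s β) (word β)) βs) ≈ map (λ β → (s β , β)) βs
  sumN-scaled-words [] s w = refl
  sumN-scaled-words (β ∷ βs) s w =
    trans (coeff-++ w (scaleN (s β) (word β)) (sumN (map (λ β → scaleN (s β) (word β)) βs)))
    (trans (cong₂ _+_ (trans (coeff-∷ w (s β * 1ℚ) β [])
                             (trans (cong (λ z → z * δ w β + 0ℚ) (ℚP.*-identityʳ (s β))) (ℚP.+-identityʳ (s β * δ w β))))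
                      (sumN-scaled-words βs s w))
           (sym (coeff-∷ w (s β) β (map (λ β → (s β , β)) βs))))

module QuasiShuffles where

  open Sums
  open SignsAndDeltas

  deconcat : Comp → List (Comp × Comp)
  deconcat [] = ([] , []) ∷ []
  deconcat (c ∷ ζ) = ([] , c ∷ ζ) ∷ map (λ s → (c ∷ proj₁ s , proj₂ s)) (deconcat ζ)

  ∑deconcat : Comp → (Comp → Comp → ℚ) → ℚ
  ∑deconcat γ Φ = ∑ (deconcat γ) (λ s → Φ (proj₁ s) (proj₂ s))

  ∑deconcat-∷ : ∀ c ζ Φ → ∑deconcat (c ∷ ζ) Φ ≡ Φ [] (c ∷ ζ) + ∑deconcat ζ (λ a b → Φ (c ∷ a) b)
  ∑deconcat-∷ c ζ Φ = cong (Φ [] (c ∷ ζ) +_) (∑-map _ (deconcat ζ) _)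

  ∑deconcat-cong : ∀ γ {Φ Ψ : Comp → Comp → ℚ} → (∀ a b → Φ a b ≡ Ψ a b) → ∑deconcat γ Φ ≡ ∑deconcat γ Ψ
  ∑deconcat-cong γ Φ≡Ψ = ∑-cong (deconcat γ) (λ s → Φ≡Ψ (proj₁ s) (proj₂ s))

  ∑deconcat-+ : ∀ γ (Φ Ψ : Comp → Comp → ℚ) → ∑deconcat γ (λ a b → Φ a b + Ψ a b) ≡ ∑deconcat γ Φ + ∑deconcat γ Ψ
  ∑deconcat-+ γ Φ Ψ = ∑-+ (deconcat γ) _ _

  ∑deconcat-δ[]ˡ : ∀ γ (f : Comp → ℚ) → ∑deconcat γ (λ a b → δ [] a * f b) ≡ f γ
  ∑deconcat-δ[]ˡ [] f = solve 1 (λ x → con 1ℚ :* x :+ con 0ℚ := x) refl (f [])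
  ∑deconcat-δ[]ˡ (c ∷ ζ) f =
    trans (∑deconcat-∷ c ζ (λ a b → δ [] a * f b))
          (trans (cong (1ℚ * f (c ∷ ζ) +_) (∑-vanish (deconcat ζ) (λ s → ℚP.*-zeroˡ (f (proj₂ s)))))
                 (solve 1 (λ x → con 1ℚ :* x :+ con 0ℚ := x) refl (f (c ∷ ζ))))

  ∑deconcat-δ[]ʳ : ∀ γ (f : Comp → ℚ) → ∑deconcat γ (λ a b → f a * δ [] b) ≡ f γ
  ∑deconcat-δ[]ʳ [] f = solve 1 (λ x → x :* con 1ℚ :+ con 0ℚ := x) refl (f [])
  ∑deconcat-δ[]ʳ (c ∷ ζ) f =
    trans (∑deconcat-∷ c ζ (λ a b → f a * δ [] b))
          (trans (cong₂ _+_ (ℚP.*-zeroʳ (f [])) (∑deconcat-δ[]ʳ ζ (λ a → f (c ∷ a)))) (ℚP.+-identityˡ _))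

  ∑deconcat-δ-δ : ∀ α β γ → ∑deconcat γ (λ s t → δ α s * δ β t) ≡ δ (α ++ β) γ
  ∑deconcat-δ-δ [] β γ = ∑deconcat-δ[]ˡ γ (δ β)
  ∑deconcat-δ-δ (a ∷ α) β [] = solve 1 (λ x → con 0ℚ :* x :+ con 0ℚ := con 0ℚ) refl (δ β [])
  ∑deconcat-δ-δ (a ∷ α) β (c ∷ ζ) =
    trans (∑deconcat-∷ c ζ (λ s t → δ (a ∷ α) s * δ β t))
    (trans (cong₂ _+_ (ℚP.*-zeroˡ (δ β (c ∷ ζ)))
                      (trans (∑deconcat-cong ζ (λ s t → trans (cong (_* δ β t) (δ-∷ a α c s)) (ℚP.*-assoc (δN a c) _ _)))
                      (trans (∑-*ˡ (δN a c) (deconcat ζ) _) (cong (δN a c *_) (∑deconcat-δ-δ α β ζ)))))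
    (trans (ℚP.+-identityˡ _) (sym (δ-∷ a (α ++ β) c ζ))))

  ∑qsh : Comp → Comp → (Comp → ℚ) → ℚ
  ∑qsh u v f = ∑ (qsh u v) f

  ∑qsh-cong : ∀ u v {f g : Comp → ℚ} → (∀ ζ → f ζ ≡ g ζ) → ∑qsh u v f ≡ ∑qsh u v g
  ∑qsh-cong u v f≡g = ∑-cong (qsh u v) f≡g

  ∑qsh-+ : ∀ u v (f g : Comp → ℚ) → ∑qsh u v (λ ζ → f ζ + g ζ) ≡ ∑qsh u v f + ∑qsh u v g
  ∑qsh-+ u v f g = ∑-+ (qsh u v) f g

  ∑qsh-∷-∷ : ∀ a u b v f → ∑qsh (a ∷ u) (b ∷ v) f
                           ≡ ∑qsh u (b ∷ v) (λ ζ → f (a ∷ ζ))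
                             + (∑qsh (a ∷ u) v (λ ζ → f (b ∷ ζ)) + ∑qsh u v (λ ζ → f (suc (a ℕ.+ b) ∷ ζ)))
  ∑qsh-∷-∷ a u b v f =
    trans (∑-++ (map (a ∷_) (qsh u (b ∷ v))) _ f)
          (cong₂ _+_ (∑-map _ (qsh u (b ∷ v)) f)
                     (trans (∑-++ (map (b ∷_) (qsh (a ∷ u) v)) _ f)
                            (cong₂ _+_ (∑-map _ (qsh (a ∷ u) v) f) (∑-map _ (qsh u v) f))))

  ∑qsh-[]ʳ : ∀ u f → ∑qsh u [] f ≡ f u + 0ℚ
  ∑qsh-[]ʳ [] f = refl
  ∑qsh-[]ʳ (a ∷ u) f = refl

  -- Deconcatenation is multiplicative for the quasi-shuffle product: Δ(M_u M_γ) = Δ(M_u) Δ(M_γ).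
  DeconcatMultiplicative : Comp → Comp → (Comp → Comp → ℚ) → Set
  DeconcatMultiplicative u γ Φ =
    ∑qsh u γ (λ ζ → ∑deconcat ζ Φ)
    ≡ ∑deconcat u (λ u₁ u₂ → ∑deconcat γ (λ γ₁ γ₂ → ∑qsh u₁ γ₁ (λ ζ₁ → ∑qsh u₂ γ₂ (λ ζ₂ → Φ ζ₁ ζ₂))))

  ∑qsh-deconcat-∷-∷ : ∀ a u b γ Φ → (∀ Ψ → DeconcatMultiplicative u (b ∷ γ) Ψ) → (∀ Ψ → DeconcatMultiplicative (a ∷ u) γ Ψ) →
                      (∀ Ψ → DeconcatMultiplicative u γ Ψ) → DeconcatMultiplicative (a ∷ u) (b ∷ γ) Φ
  ∑qsh-deconcat-∷-∷ a u b γ Φ ih₁ ih₂ ih₃ = trans qsh-side (sym deconcat-side)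
    where
    c : ℕ
    c = suc (a ℕ.+ b)
    Φ[] SA SE SB SC : ℚ
    X : Comp → Comp → Comp → Comp → ℚ
    X u₁ u₂ γ₁ γ₂ = ∑qsh u₁ γ₁ (λ ζ₁ → ∑qsh u₂ γ₂ (λ ζ₂ → Φ ζ₁ ζ₂))
    Fu A B C : Comp → Comp → ℚ
    Fu u₁ u₂ = ∑qsh u₂ (b ∷ γ) (Φ (a ∷ u₁))
    A u₁ u₂ = ∑deconcat γ (λ γ₁ γ₂ → ∑qsh u₁ (b ∷ γ₁) (λ ζ₁ → ∑qsh u₂ γ₂ (λ ζ₂ → Φ (a ∷ ζ₁) ζ₂)))
    B u₁ u₂ = ∑deconcat γ (λ γ₁ γ₂ → ∑qsh (a ∷ u₁) γ₁ (λ ζ₁ → ∑qsh u₂ γ₂ (λ ζ₂ → Φ (b ∷ ζ₁) ζ₂)))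
    C u₁ u₂ = ∑deconcat γ (λ γ₁ γ₂ → ∑qsh u₁ γ₁ (λ ζ₁ → ∑qsh u₂ γ₂ (λ ζ₂ → Φ (c ∷ ζ₁) ζ₂)))
    Φ[] = ∑qsh (a ∷ u) (b ∷ γ) (Φ [])
    SA = ∑deconcat u (λ u₁ u₂ → (Fu u₁ u₂ + 0ℚ) + A u₁ u₂)
    SE = ∑deconcat γ (λ γ₁ γ₂ → ∑qsh (a ∷ u) γ₂ (Φ (b ∷ γ₁)) + 0ℚ)
    SB = ∑deconcat u B
    SC = ∑deconcat u C
    split : ∀ k x y → ∑qsh x y (λ ζ → ∑deconcat (k ∷ ζ) Φ)
                      ≡ ∑qsh x y (λ ζ → Φ [] (k ∷ ζ)) + ∑qsh x y (λ ζ → ∑deconcat ζ (λ s t → Φ (k ∷ s) t))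
    split k x y = trans (∑qsh-cong x y (λ ζ → ∑deconcat-∷ k ζ Φ)) (∑qsh-+ x y _ _)
    via-ih₁ : ∑qsh u (b ∷ γ) (λ ζ → ∑deconcat ζ (λ s t → Φ (a ∷ s) t)) ≡ SA
    via-ih₁ = trans (ih₁ _) (∑deconcat-cong u (λ u₁ u₂ →
                trans (∑deconcat-∷ b γ (λ γ₁ γ₂ → ∑qsh u₁ γ₁ (λ ζ₁ → ∑qsh u₂ γ₂ (λ ζ₂ → Φ (a ∷ ζ₁) ζ₂))))
                      (cong (_+ A u₁ u₂) (∑qsh-[]ʳ u₁ (λ ζ₁ → ∑qsh u₂ (b ∷ γ) (λ ζ₂ → Φ (a ∷ ζ₁) ζ₂))))))
    via-ih₂ : ∑qsh (a ∷ u) γ (λ ζ → ∑deconcat ζ (λ s t → Φ (b ∷ s) t)) ≡ SE + SB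
    via-ih₂ = trans (ih₂ _) (∑deconcat-∷ a u (λ u₁ u₂ → ∑deconcat γ (λ γ₁ γ₂ → ∑qsh u₁ γ₁ (λ ζ₁ → ∑qsh u₂ γ₂ (λ ζ₂ → Φ (b ∷ ζ₁) ζ₂)))))
    qsh-side : ∑qsh (a ∷ u) (b ∷ γ) (λ ζ → ∑deconcat ζ Φ) ≡ Φ[] + (SA + ((SE + SB) + SC))
    qsh-side =
      trans (∑qsh-∷-∷ a u b γ (λ ζ → ∑deconcat ζ Φ))
      (trans (cong₂ _+_ (split a u (b ∷ γ)) (cong₂ _+_ (split b (a ∷ u) γ) (split c u γ)))
      (trans (cong₂ (λ x y → (∑qsh u (b ∷ γ) (λ ζ → Φ [] (a ∷ ζ)) + x)
                               + ((∑qsh (a ∷ u) γ (λ ζ → Φ [] (b ∷ ζ)) + y) + (∑qsh u γ (λ ζ → Φ [] (c ∷ ζ)) + ∑qsh u γ (λ ζ → ∑deconcat ζ (λ s t → Φ (c ∷ s) t)))))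
                    via-ih₁ via-ih₂)
      (trans (cong (λ z → (∑qsh u (b ∷ γ) (λ ζ → Φ [] (a ∷ ζ)) + SA)
                          + ((∑qsh (a ∷ u) γ (λ ζ → Φ [] (b ∷ ζ)) + (SE + SB)) + (∑qsh u γ (λ ζ → Φ [] (c ∷ ζ)) + z)))
                   (ih₃ _))
      (trans (solve 7 (λ x₁ x₂ x₃ sa se sb sc → (x₁ :+ sa) :+ ((x₂ :+ (se :+ sb)) :+ (x₃ :+ sc))
                                              := (x₁ :+ (x₂ :+ x₃)) :+ (sa :+ ((se :+ sb) :+ sc))) refl
                   (∑qsh u (b ∷ γ) (λ ζ → Φ [] (a ∷ ζ))) (∑qsh (a ∷ u) γ (λ ζ → Φ [] (b ∷ ζ)))
                   (∑qsh u γ (λ ζ → Φ [] (c ∷ ζ))) SA SE SB SC)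
             (cong (_+ (SA + ((SE + SB) + SC))) (sym (∑qsh-∷-∷ a u b γ (Φ []))))))))
    inner : ∀ u₁ u₂ → ∑deconcat (b ∷ γ) (X (a ∷ u₁) u₂) ≡ ((Fu u₁ u₂ + 0ℚ) + A u₁ u₂) + (B u₁ u₂ + C u₁ u₂)
    inner u₁ u₂ =
      trans (∑deconcat-∷ b γ (X (a ∷ u₁) u₂))
      (trans (cong ((Fu u₁ u₂ + 0ℚ) +_)
                   (trans (∑deconcat-cong γ (λ γ₁ γ₂ → ∑qsh-∷-∷ a u₁ b γ₁ _))
                   (trans (∑deconcat-+ γ _ _) (cong (A u₁ u₂ +_) (∑deconcat-+ γ _ _)))))
             (solve 4 (λ f x y z → f :+ (x :+ (y :+ z)) := (f :+ x) :+ (y :+ z)) refl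
                    (Fu u₁ u₂ + 0ℚ) (A u₁ u₂) (B u₁ u₂) (C u₁ u₂)))
    deconcat-side : ∑deconcat (a ∷ u) (λ u₁ u₂ → ∑deconcat (b ∷ γ) (X u₁ u₂)) ≡ Φ[] + (SA + ((SE + SB) + SC))
    deconcat-side =
      trans (∑deconcat-∷ a u (λ u₁ u₂ → ∑deconcat (b ∷ γ) (X u₁ u₂)))
      (trans (cong₂ _+_ (∑deconcat-∷ b γ (X [] (a ∷ u)))
                        (trans (∑deconcat-cong u inner)
                        (trans (∑deconcat-+ u _ _) (cong (SA +_) (∑deconcat-+ u B C)))))
             (solve 5 (λ pp sa se sb sc → (pp :+ con 0ℚ :+ se) :+ (sa :+ (sb :+ sc)) := pp :+ (sa :+ ((se :+ sb) :+ sc))) refl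
                    Φ[] SA SE SB SC))

  ∑qsh-deconcat : ∀ u γ (Φ : Comp → Comp → ℚ) → DeconcatMultiplicative u γ Φ
  ∑qsh-deconcat [] γ Φ =
    trans (ℚP.+-identityʳ (∑deconcat γ Φ))
          (sym (trans (ℚP.+-identityʳ _)
                      (∑deconcat-cong γ (λ γ₁ γ₂ → trans (ℚP.+-identityʳ (Φ γ₁ γ₂ + 0ℚ)) (ℚP.+-identityʳ (Φ γ₁ γ₂))))))
  ∑qsh-deconcat (a ∷ u) [] Φ =
    trans (ℚP.+-identityʳ (∑deconcat (a ∷ u) Φ))
          (sym (∑deconcat-cong (a ∷ u) (λ u₁ u₂ →
                  trans (ℚP.+-identityʳ (∑qsh u₁ [] (λ ζ₁ → ∑qsh u₂ [] (Φ ζ₁))))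
                  (trans (∑qsh-[]ʳ u₁ (λ ζ₁ → ∑qsh u₂ [] (Φ ζ₁)))
                  (trans (ℚP.+-identityʳ (∑qsh u₂ [] (Φ u₁)))
                  (trans (∑qsh-[]ʳ u₂ (Φ u₁)) (ℚP.+-identityʳ (Φ u₁ u₂))))))))
  ∑qsh-deconcat (a ∷ u) (b ∷ γ) Φ =
    ∑qsh-deconcat-∷-∷ a u b γ Φ (∑qsh-deconcat u (b ∷ γ)) (∑qsh-deconcat (a ∷ u) γ) (∑qsh-deconcat u γ)

  ∑qsh-cong-size : ∀ u v {f g : Comp → ℚ} → (∀ ζ → size ζ ≡ size u ℕ.+ size v → f ζ ≡ g ζ) → ∑qsh u v f ≡ ∑qsh u v g
  ∑qsh-cong-size [] v f≡g = cong (_+ 0ℚ) (f≡g v refl)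
  ∑qsh-cong-size (a ∷ u) [] f≡g = cong (_+ 0ℚ) (f≡g (a ∷ u) (sym (ℕP.+-identityʳ _)))
  ∑qsh-cong-size (a ∷ u) (b ∷ v) {f} {g} f≡g =
    trans (∑qsh-∷-∷ a u b v f)
    (trans (cong₂ _+_ (∑qsh-cong-size u (b ∷ v) (λ ζ s → f≡g (a ∷ ζ) (left ζ s)))
                      (cong₂ _+_ (∑qsh-cong-size (a ∷ u) v (λ ζ s → f≡g (b ∷ ζ) (right ζ s)))
                                 (∑qsh-cong-size u v (λ ζ s → f≡g (suc (a ℕ.+ b) ∷ ζ) (both ζ s)))))
           (sym (∑qsh-∷-∷ a u b v g)))
    where
    open +-*-Solver using () renaming (solve to ℕ-solve; _:+_ to _⊕_; _:=_ to _≐_; con to ℕcon)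
    left : ∀ ζ → size ζ ≡ size u ℕ.+ size (b ∷ v) → size (a ∷ ζ) ≡ size (a ∷ u) ℕ.+ size (b ∷ v)
    left ζ s = trans (cong (suc a ℕ.+_) s) (sym (ℕP.+-assoc (suc a) (size u) (size (b ∷ v))))
    right : ∀ ζ → size ζ ≡ size (a ∷ u) ℕ.+ size v → size (b ∷ ζ) ≡ size (a ∷ u) ℕ.+ size (b ∷ v)
    right ζ s = trans (cong (suc b ℕ.+_) s)
      (ℕ-solve 4 (λ a b x y → (ℕcon 1 ⊕ b) ⊕ ((ℕcon 1 ⊕ a ⊕ x) ⊕ y) ≐ (ℕcon 1 ⊕ a ⊕ x) ⊕ ((ℕcon 1 ⊕ b) ⊕ y)) refl
               a b (size u) (size v))
    both : ∀ ζ → size ζ ≡ size u ℕ.+ size v → size (suc (a ℕ.+ b) ∷ ζ) ≡ size (a ∷ u) ℕ.+ size (b ∷ v)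
    both ζ s = trans (cong (suc (suc (a ℕ.+ b)) ℕ.+_) s)
      (ℕ-solve 4 (λ a b x y → (ℕcon 2 ⊕ (a ⊕ b)) ⊕ (x ⊕ y) ≐ (ℕcon 1 ⊕ a ⊕ x) ⊕ (ℕcon 1 ⊕ b ⊕ y)) refl
               a b (size u) (size v))

  ∑qsh-sgn-length : ∀ u v → ∑qsh u v (λ ζ → sgn (length ζ)) ≡ sgn (length u ℕ.+ length v)
  ∑qsh-sgn-length [] v = ℚP.+-identityʳ _
  ∑qsh-sgn-length (a ∷ u) [] = trans (ℚP.+-identityʳ _) (cong sgn (sym (ℕP.+-identityʳ (suc (length u)))))
  ∑qsh-sgn-length (a ∷ u) (b ∷ v) =
    trans (∑qsh-∷-∷ a u b v (λ ζ → sgn (length ζ)))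
    (trans (cong₂ _+_ (flip u (b ∷ v)) (cong₂ _+_ (flip (a ∷ u) v) (flip u v)))
    (trans (cong (λ k → - k + (- sgn (suc (length u) ℕ.+ length v) + - sgn (length u ℕ.+ length v)))
                 (cong sgn (ℕP.+-suc (length u) (length v))))
    (trans (solve 1 (λ x → :- (:- x) :+ (:- (:- x) :+ :- x) := x) refl (sgn (length u ℕ.+ length v)))
           (sym (trans (cong (λ k → - sgn k) (ℕP.+-suc (length u) (length v)))
                       (solve 1 (λ y → :- (:- y) := y) refl (sgn (length u ℕ.+ length v))))))))
    where
    flip : ∀ u′ v′ → ∑ (qsh u′ v′) (λ ζ → - sgn (length ζ)) ≡ - sgn (length u′ ℕ.+ length v′)
    flip u′ v′ = trans (∑-neg (qsh u′ v′) _) (cong -_ (∑qsh-sgn-length u′ v′))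

  length≤size : ∀ ζ → length ζ ≤ size ζ
  length≤size [] = z≤n
  length≤size (a ∷ ζ) = s≤s (ℕP.≤-trans (length≤size ζ) (ℕP.m≤n+m _ a))

  ∑-∑-deconcat : ∀ {A B : Set} (xs : List A) (ys : List B) γ (f : A → Comp → ℚ) (g : B → Comp → ℚ) →
                 ∑ xs (λ x → ∑ ys (λ y → ∑deconcat γ (λ γ₁ γ₂ → f x γ₁ * g y γ₂)))
                 ≡ ∑deconcat γ (λ γ₁ γ₂ → ∑ xs (λ x → f x γ₁) * ∑ ys (λ y → g y γ₂))
  ∑-∑-deconcat xs ys γ f g =
    trans (∑-cong xs (λ x → ∑-swap ys (deconcat γ) _))
          (trans (∑-swap xs (deconcat γ) _)
                 (∑-cong (deconcat γ) (λ s → ∑-*-∑ xs ys (λ x → f x (proj₁ s)) (λ y → g y (proj₂ s)))))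

module Antidiagonals where

  open Sums
  open CutVectors
  open QuasiShuffles

  antidiagonal : ℕ → List (ℕ × ℕ)
  antidiagonal zero = (0 , 0) ∷ []
  antidiagonal (suc i) = (0 , suc i) ∷ map (λ s → (suc (proj₁ s) , proj₂ s)) (antidiagonal i)

  ∑-antidiagonal-cong : ∀ m {f g : ℕ × ℕ → ℚ} → (∀ a b → a ℕ.+ b ≡ m → f (a , b) ≡ g (a , b)) →
                        ∑ (antidiagonal m) f ≡ ∑ (antidiagonal m) g
  ∑-antidiagonal-cong zero f≡g = cong (_+ 0ℚ) (f≡g 0 0 refl)
  ∑-antidiagonal-cong (suc m) {f} {g} f≡g =
    cong₂ _+_ (f≡g 0 (suc m) refl)
              (trans (∑-map _ (antidiagonal m) f)
              (trans (∑-antidiagonal-cong m (λ a b a+b≡m → f≡g (suc a) b (cong suc a+b≡m)))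
                     (sym (∑-map _ (antidiagonal m) g))))

  ∑-antidiagonal-assoc : ∀ m (H : ℕ → ℕ → ℕ → ℚ) →
                         ∑ (antidiagonal m) (λ s → ∑ (antidiagonal (proj₂ s)) (λ t → H (proj₁ s) (proj₁ t) (proj₂ t)))
                         ≡ ∑ (antidiagonal m) (λ s → ∑ (antidiagonal (proj₁ s)) (λ t → H (proj₁ t) (proj₂ t) (proj₂ s)))
  ∑-antidiagonal-assoc zero H = refl
  ∑-antidiagonal-assoc (suc m) H =
    trans (cong₂ _+_ (cong (H 0 0 (suc m) +_) (∑-map _ (antidiagonal m) _))
                     (trans (∑-map _ (antidiagonal m) _) (∑-antidiagonal-assoc m (λ a c d → H (suc a) c d))))
    (trans (solve 3 (λ x y z → (x :+ y) :+ z := (x :+ con 0ℚ) :+ (y :+ z)) refl (H 0 0 (suc m))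
                    (∑ (antidiagonal m) (λ s → H 0 (suc (proj₁ s)) (proj₂ s)))
                    (∑ (antidiagonal m) (λ s → ∑ (antidiagonal (proj₁ s)) (λ t → H (suc (proj₁ t)) (proj₂ t) (proj₂ s)))))
    (cong ((H 0 0 (suc m) + 0ℚ) +_)
          (sym (trans (∑-map _ (antidiagonal m) _)
               (trans (∑-cong (antidiagonal m) (λ s → cong (H 0 (suc (proj₁ s)) (proj₂ s) +_) (∑-map _ (antidiagonal (proj₁ s)) _)))
                      (∑-+ (antidiagonal m) _ _))))))

  ∑deconcat-ones : ∀ i (Φ : Comp → Comp → ℚ) → ∑deconcat (ones i) Φ ≡ ∑ (antidiagonal i) (λ s → Φ (ones (proj₁ s)) (ones (proj₂ s)))
  ∑deconcat-ones zero Φ = refl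
  ∑deconcat-ones (suc i) Φ =
    trans (∑deconcat-∷ 0 (ones i) Φ)
          (cong (Φ [] (ones (suc i)) +_) (trans (∑deconcat-ones i (λ a b → Φ (0 ∷ a) b)) (sym (∑-map _ (antidiagonal i) _))))

  compositionsOf : ℕ → List Comp
  compositionsOf i = refinements (row i)

  ∑-compositionsOf-suc : ∀ m (f : Comp → ℚ) → ∑ (compositionsOf (suc m)) f ≡ ∑ (vectors m) (λ z → f (comp z))
  ∑-compositionsOf-suc m f = ∑-refinements m [] f

  ∑-compositionsOf-head : ∀ m (f : Comp → ℚ) →
                          ∑ (compositionsOf (suc m)) f ≡ ∑ (antidiagonal m) (λ s → ∑ (compositionsOf (proj₂ s)) (λ β → f (proj₁ s ∷ β)))
  ∑-compositionsOf-head zero f =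
    trans (∑-compositionsOf-suc 0 f) (solve 1 (λ x → x :+ con 0ℚ := (x :+ con 0ℚ) :+ con 0ℚ) refl (f (0 ∷ [])))
  ∑-compositionsOf-head (suc m) f =
    trans (∑-compositionsOf-suc (suc m) f)
    (trans (∑-branch (vectors m) _)
    (trans (∑-+ (vectors m) _ _)
           (cong₂ _+_ (sym (∑-compositionsOf-suc m (λ β → f (0 ∷ β))))
                      (trans (sym (∑-compositionsOf-suc m f⁺))
                      (trans (∑-compositionsOf-head m f⁺) (sym (∑-map _ (antidiagonal m) _)))))))
    where
    f⁺ : Comp → ℚ
    f⁺ [] = 0ℚ
    f⁺ (a ∷ β) = f (suc a ∷ β)

  ∑-compositionsOf-deconcat : ∀ i Φ →
                              ∑ (compositionsOf i) (λ β → ∑deconcat β Φ)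
                              ≡ ∑ (antidiagonal i) (λ s → ∑ (compositionsOf (proj₁ s)) (λ β₁ → ∑ (compositionsOf (proj₂ s)) (λ β₂ → Φ β₁ β₂)))
  ∑-compositionsOf-deconcat i = go i i ℕP.≤-refl
    where
    go : ∀ N i → i ≤ N → ∀ Φ →
         ∑ (compositionsOf i) (λ β → ∑deconcat β Φ)
         ≡ ∑ (antidiagonal i) (λ s → ∑ (compositionsOf (proj₁ s)) (λ β₁ → ∑ (compositionsOf (proj₂ s)) (λ β₂ → Φ β₁ β₂)))
    go N zero _ Φ = solve 1 (λ x → (x :+ con 0ℚ) :+ con 0ℚ := ((x :+ con 0ℚ) :+ con 0ℚ) :+ con 0ℚ) refl (Φ [] [])
    go (suc N) (suc m) (s≤s m≤N) Φ =
      trans (∑-compositionsOf-head m (λ β → ∑deconcat β Φ))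
      (trans (∑-antidiagonal-cong m (λ a b a+b≡m →
               trans (∑-cong (compositionsOf b) (λ β₂ → ∑deconcat-∷ a β₂ Φ))
               (trans (∑-+ (compositionsOf b) _ _)
                      (cong (∑ (compositionsOf b) (λ β₂ → Φ [] (a ∷ β₂)) +_)
                            (go N b (ℕP.≤-trans (subst (b ≤_) a+b≡m (ℕP.m≤n+m b a)) m≤N) (λ x y → Φ (a ∷ x) y))))))
      (trans (∑-+ (antidiagonal m) _ _)
      (sym (trans (cong₂ _+_ (trans (ℚP.+-identityʳ _) (∑-compositionsOf-head m (Φ []))) (∑-map _ (antidiagonal m) _))
           (cong (∑ (antidiagonal m) (λ s → ∑ (compositionsOf (proj₂ s)) (λ β₂ → Φ [] (proj₁ s ∷ β₂))) +_)
                 (trans (∑-cong (antidiagonal m) (λ s → ∑-compositionsOf-head (proj₁ s) (λ β₁ → ∑ (compositionsOf (proj₂ s)) (λ β₂ → Φ β₁ β₂))))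
                        (sym (∑-antidiagonal-assoc m (λ a c d → ∑ (compositionsOf c) (λ β₁ → ∑ (compositionsOf d) (λ β₂ → Φ (a ∷ β₁) β₂)))))))))))

module HBasis where

  open Sums
  open LinearFunctionals
  open NSymAlgebra
  open CutVectors
  open CutSigns

  eval-h : ∀ φ a → eval φ (h (ℤ.+ suc a)) ≡ ∑ (vectors a) (λ y → τ y * φ (comp y))
  eval-h φ a =
    trans (∑-map _ (comps (suc a)) (λ x → proj₁ x * φ (proj₂ x)))
    (trans (cong (λ l → ∑ l (λ β → sgn (suc a ℕ.∸ length β) * φ β)) (comps≡map-comp-vectors a))
    (trans (∑-map comp (vectors a) _)
           (∑-vectors-cong a (λ y length≡a → cong (_* φ (comp y)) (sgn-njoin y a length≡a)))))

  eval-hComp : ∀ φ a α → eval φ (hComp (a ∷ α)) ≡ ∑ (supersets (cuts a α)) (λ z → τ z * φ (comp z))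
  eval-hComp φ a [] =
    trans (eval-*N φ (h (ℤ.+ suc a)) oneN)
    (trans (eval-cong (h (ℤ.+ suc a)) (λ u → trans (eval-singleton (λ v → φ (u ++ v)) []) (cong φ (++-identityʳ u))))
           (eval-h φ a))
  eval-hComp φ a (b ∷ β) =
    trans (eval-*N φ (h (ℤ.+ suc a)) (hComp (b ∷ β)))
    (trans (eval-cong (h (ℤ.+ suc a)) (λ u → eval-hComp (λ v → φ (u ++ v)) b β))
    (trans (eval-h _ a)
    (trans (∑-vectors-cong a (λ y _ → cut-after y))
           (sym (trans (∑-supersets-++ (noCuts a) (true ∷ cuts b β) _)
                       (∑-vectors-cong a (λ y _ → ∑-map (true ∷_) (supersets (cuts b β)) _)))))))
    where
    cut-after : ∀ y → τ y * ∑ (supersets (cuts b β)) (λ z → τ z * φ (comp y ++ comp z))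
                      ≡ ∑ (supersets (cuts b β)) (λ z → τ (y ++ true ∷ z) * φ (comp (y ++ true ∷ z)))
    cut-after y =
      trans (sym (∑-*ˡ (τ y) (supersets (cuts b β)) _))
            (∑-cong (supersets (cuts b β)) (λ z →
              trans (sym (ℚP.*-assoc (τ y) (τ z) _))
                    (cong₂ _*_ (sym (τ-cut-++ y z)) (cong φ (sym (comp-cut-++ y z))))))

  eval-hComp-comp : ∀ φ y → eval φ (hComp (comp y)) ≡ ∑ (supersets y) (λ z → τ z * φ (comp z))
  eval-hComp-comp φ y =
    trans (eval-hComp φ (proj₁ (comp′ y)) (proj₂ (comp′ y)))
          (cong (λ v → ∑ (supersets v) (λ z → τ z * φ (comp z))) (cuts-comp y))

module Duality (p : Comp → Comp → ℚ) (dual : IsDualPairing p) where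

  open Sums
  open SignsAndDeltas
  open LinearFunctionals
  open NSymAlgebra
  open CutVectors
  open CutSigns
  open Möbius
  open HBasis
  open QuasiShuffles

  pairing-r : ∀ α g → pairing p (r α) g ≡ ∑ (coarsenings α) (λ β → sgn (length α ℕ.∸ length β) * pairing p (hComp β) g)
  pairing-r α g =
    trans (pairing-sumNˡ p (map (λ β → scaleN (sgn (length α ℕ.∸ length β)) (hComp β)) (coarsenings α)) g)
    (trans (∑-map (λ β → scaleN (sgn (length α ℕ.∸ length β)) (hComp β)) (coarsenings α) (λ a → pairing p a g))
           (∑-cong (coarsenings α) (λ β → pairing-scaleNˡ p (sgn (length α ℕ.∸ length β)) (hComp β) g)))

  pairing-hComp≡∑-pairing-r : ∀ u g → pairing p (hComp u) g ≡ ∑ (coarsenings u) (λ α → pairing p (r α) g)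
  pairing-hComp≡∑-pairing-r [] g =
    sym (trans (cong (_+ 0ℚ) (pairing-r [] g))
               (solve 1 (λ x → (con 1ℚ :* x :+ con 0ℚ) :+ con 0ℚ := x) refl (pairing p (hComp []) g)))
  pairing-hComp≡∑-pairing-r (a ∷ α) g =
    subst (λ u → pairing p (hComp u) g ≡ ∑ (coarsenings u) (λ α → pairing p (r α) g)) (comp-cuts a α) (via-cuts (cuts a α))
    where
    via-cuts : ∀ x → pairing p (hComp (comp x)) g ≡ ∑ (coarsenings (comp x)) (λ α → pairing p (r α) g)
    via-cuts x =
      sym (trans (∑-coarsenings-comp x _)
          (trans (∑-subsets-cong x (λ y _ →
                    trans (pairing-r (comp y) g)
                    (trans (∑-coarsenings-comp y _)
                           (∑-subsets-cong y (λ w w⊆y → cong (_* pairing p (hComp (comp w)) g) (sgn-length-∸ w⊆y))))))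
                 (möbius-subsets x (λ w → pairing p (hComp (comp w)) g))))

  pairing-F : ∀ a β → pairing p a (F β) ≡ ∑ (refinements β) (λ γ → pairing p a (M γ))
  pairing-F a β =
    trans (pairing-expand-M p a (F β))
          (trans (∑-map _ (refinements β) _) (∑-cong (refinements β) (λ γ → ℚP.*-identityˡ _)))

  pairing-M≡∑-pairing-F : ∀ a γ → pairing p a (M γ) ≡ ∑ (refinements γ) (λ β → sgn (length β ℕ.∸ length γ) * pairing p a (F β))
  pairing-M≡∑-pairing-F a [] =
    sym (trans (cong (λ v → 1ℚ * v + 0ℚ) (pairing-F a []))
               (solve 1 (λ x → con 1ℚ :* (x :+ con 0ℚ) :+ con 0ℚ := x) refl (pairing p a (M []))))
  pairing-M≡∑-pairing-F a (b ∷ β) =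
    subst (λ γ → pairing p a (M γ) ≡ ∑ (refinements γ) (λ β → sgn (length β ℕ.∸ length γ) * pairing p a (F β)))
          (comp-cuts b β) (via-cuts (cuts b β))
    where
    via-cuts : ∀ x → pairing p a (M (comp x)) ≡ ∑ (refinements (comp x)) (λ β → sgn (length β ℕ.∸ length (comp x)) * pairing p a (F β))
    via-cuts x =
      sym (trans (∑-refinements-comp x _)
          (trans (∑-supersets-cong x (λ y x⊆y → cong₂ _*_ (sgn-length-∸ x⊆y) (trans (pairing-F a (comp y)) (∑-refinements-comp y _))))
                 (möbius-supersets x (λ z → pairing p a (M (comp z))))))

  signedIncidence : Comp → Comp → ℚ
  signedIncidence u γ = ∑ (refinements γ) (λ β → sgn (length β ℕ.∸ length γ) * ∑ (coarsenings u) (λ α → δ α β))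

  pairing-hComp-M≡signedIncidence : ∀ u γ → pairing p (hComp u) (M γ) ≡ signedIncidence u γ
  pairing-hComp-M≡signedIncidence u γ =
    trans (pairing-M≡∑-pairing-F (hComp u) γ)
          (∑-cong (refinements γ) (λ β → cong (sgn (length β ℕ.∸ length γ) *_)
                  (trans (pairing-hComp≡∑-pairing-r u (F β)) (∑-cong (coarsenings u) (λ α → dual α β)))))

  signedIncidence-comp : ∀ x c → signedIncidence (comp x) (comp c) ≡ δ (comp x) (comp c)
  signedIncidence-comp x c =
    trans (∑-refinements-comp c _)
    (trans (∑-supersets-cong c (λ y c⊆y → cong₂ _*_ (sgn-length-∸ c⊆y)
                                              (trans (∑-coarsenings-comp x _) (∑-cong (subsets x) (λ w → δ-comp w y)))))
    (trans (möbius-inclusion c x) (sym (δ-comp x c))))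

  pairing-hComp-M : ∀ u γ → pairing p (hComp u) (M γ) ≡ δ u γ
  pairing-hComp-M [] [] = pairing-hComp-M≡signedIncidence [] []
  pairing-hComp-M [] (a ∷ α) =
    trans (pairing-hComp-M≡signedIncidence [] (a ∷ α))
          (trans (∑-refinements a α _)
                 (∑-vanish (supersets (cuts a α)) (λ y → *-vanishʳ (sgn (length (comp y) ℕ.∸ length (a ∷ α))) refl)))
  pairing-hComp-M (a ∷ α) [] =
    trans (pairing-hComp-M≡signedIncidence (a ∷ α) [])
          (cong (λ v → 1ℚ * v + 0ℚ) (trans (∑-coarsenings a α _) (∑-zero (subsets (cuts a α)))))
  pairing-hComp-M (a ∷ α) (b ∷ β) =
    trans (pairing-hComp-M≡signedIncidence (a ∷ α) (b ∷ β))
          (subst₂ (λ u γ → signedIncidence u γ ≡ δ u γ) (comp-cuts a α) (comp-cuts b β) (signedIncidence-comp (cuts a α) (cuts b β)))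

  pairingEM : Comp → Comp → ℚ
  pairingEM [] γ = δ [] γ
  pairingEM (a ∷ α) γ = ∑ (supersets (cuts a α)) (λ y → τ y * δ (comp y) γ)

  p≡pairingEM : ∀ w γ → p w γ ≡ pairingEM w γ
  p≡pairingEM [] γ =
    trans (sym (eval-singleton (λ w → p w γ) [])) (trans (sym (pairing-M p (hComp []) γ)) (pairing-hComp-M [] γ))
  p≡pairingEM (a ∷ α) γ = trans (cong (λ u → p u γ) (sym (comp-cuts a α))) (p-comp (cuts a α))
    where
    p-comp : ∀ x → p (comp x) γ ≡ ∑ (supersets x) (λ y → τ y * δ (comp y) γ)
    p-comp x =
      trans (sym (τ-transform-involutive x (λ z → p (comp z) γ)))
            (∑-cong (supersets x) (λ y → cong (τ y *_)
              (trans (sym (eval-hComp-comp (λ w → p w γ) y))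
              (trans (sym (pairing-M p (hComp (comp y)) γ)) (pairing-hComp-M (comp y) γ)))))

  p-size-mismatch : ∀ w γ → ¬ (size w ≡ size γ) → p w γ ≡ 0ℚ
  p-size-mismatch [] γ size≢ = trans (p≡pairingEM [] γ) (δ-size [] γ size≢)
  p-size-mismatch (a ∷ α) γ size≢ =
    trans (p≡pairingEM (a ∷ α) γ)
          (trans (∑-supersets-cong (cuts a α) {g = λ _ → 0ℚ} (λ y x⊆y → *-vanishʳ (τ y) (δ-size (comp y) γ (λ eq → size≢ (sizes x⊆y eq)))))
                 (∑-zero (supersets (cuts a α))))
    where
    sizes : ∀ {y} → cuts a α ⊆ y → size (comp y) ≡ size γ → size (a ∷ α) ≡ size γ
    sizes {y} x⊆y eq = begin
      size (a ∷ α)              ≡⟨ cong size (comp-cuts a α) ⟨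
      size (comp (cuts a α))    ≡⟨ size-comp (cuts a α) ⟩
      suc (length (cuts a α))   ≡⟨ cong suc (⊆-length x⊆y) ⟩
      suc (length y)            ≡⟨ size-comp y ⟨
      size (comp y)             ≡⟨ eq ⟩
      size γ                    ∎
      where open ≡-Reasoning

  dualWord : Comp → QSym
  dualWord [] = M []
  dualWord (a ∷ α) = map (λ c → (τ c * σ c * σ (cuts a α) , comp c)) (subsets (cuts a α))

  eval-p-dualWord : ∀ w v → eval (p v) (dualWord w) ≡ δ v w
  eval-p-dualWord [] [] = trans (eval-singleton (p []) []) (p≡pairingEM [] [])
  eval-p-dualWord [] (b ∷ β) =
    trans (eval-singleton (p (b ∷ β)) [])
          (trans (p≡pairingEM (b ∷ β) []) (∑-vanish (supersets (cuts b β)) (λ y → *-vanishʳ (τ y) refl)))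
  eval-p-dualWord (a ∷ α) [] =
    trans (∑-map _ (subsets (cuts a α)) _)
          (∑-vanish (subsets (cuts a α)) (λ c → *-vanishʳ (τ c * σ c * σ (cuts a α)) (p≡pairingEM [] (comp c))))
  eval-p-dualWord (a ∷ α) (b ∷ β) =
    trans (∑-map _ (subsets (cuts a α)) _)
    (trans (∑-cong (subsets (cuts a α)) (λ c → cong (τ c * σ c * σ (cuts a α) *_)
             (trans (p≡pairingEM (b ∷ β) (comp c)) (∑-cong (supersets (cuts b β)) (λ y → cong (τ y *_) (δ-comp y c))))))
    (trans (τ-up-inverse (cuts a α) (cuts b β))
    (trans (sym (δ-comp (cuts b β) (cuts a α))) (cong₂ δ (comp-cuts b β) (comp-cuts a α)))))

  pairing-dualWord : ∀ w a → pairing p a (dualWord w) ≡ coeff w a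
  pairing-dualWord w a =
    trans (pairing≡eval p a (dualWord w))
          (trans (eval-cong a (λ v → trans (eval-p-dualWord w v) (δ-sym v w))) (sym (coeff≡eval-δ w a)))

  ≈-from-pairing-M : ∀ {a b} → (∀ γ → pairing p a (M γ) ≡ pairing p b (M γ)) → a ≈ b
  ≈-from-pairing-M {a} {b} same-pairings w = begin
    coeff w a                                  ≡⟨ pairing-dualWord w a ⟨
    pairing p a (dualWord w)                   ≡⟨ pairing-expand-M p a (dualWord w) ⟩
    eval (λ γ → pairing p a (M γ)) (dualWord w) ≡⟨ eval-cong (dualWord w) same-pairings ⟩
    eval (λ γ → pairing p b (M γ)) (dualWord w) ≡⟨ pairing-expand-M p b (dualWord w) ⟨
    pairing p b (dualWord w)                   ≡⟨ pairing-dualWord w b ⟩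
    coeff w b                                  ∎
    where open ≡-Reasoning

  p-++ : ∀ u v γ → p (u ++ v) γ ≡ ∑deconcat γ (λ γ₁ γ₂ → p u γ₁ * p v γ₂)
  p-++ [] v γ =
    sym (trans (∑deconcat-cong γ (λ γ₁ γ₂ → cong (_* p v γ₂) (p≡pairingEM [] γ₁))) (∑deconcat-δ[]ˡ γ (p v)))
  p-++ (a ∷ α) [] γ =
    trans (cong (λ w → p w γ) (++-identityʳ (a ∷ α)))
          (sym (trans (∑deconcat-cong γ (λ γ₁ γ₂ → cong (p (a ∷ α) γ₁ *_) (p≡pairingEM [] γ₂))) (∑deconcat-δ[]ʳ γ (p (a ∷ α)))))
  p-++ (a ∷ α) (b ∷ β) γ =
    trans (p≡pairingEM (a ∷ (α ++ b ∷ β)) γ)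
    (trans (cong (λ z → ∑ (supersets z) term) (cuts-++ a α b β))
    (trans (∑-supersets-++ (cuts a α) (true ∷ cuts b β) term)
    (trans (∑-cong (supersets (cuts a α)) (λ y₁ → trans (∑-map _ (supersets (cuts b β)) _)
                                                         (∑-cong (supersets (cuts b β)) (λ y₂ → term-cut y₁ y₂))))
    (trans (∑-∑-deconcat (supersets (cuts a α)) (supersets (cuts b β)) γ (λ y₁ γ₁ → τ y₁ * δ (comp y₁) γ₁) (λ y₂ γ₂ → τ y₂ * δ (comp y₂) γ₂))
           (∑deconcat-cong γ (λ γ₁ γ₂ → sym (cong₂ _*_ (p≡pairingEM (a ∷ α) γ₁) (p≡pairingEM (b ∷ β) γ₂))))))))
    where
    term : List Bool → ℚ
    term y = τ y * δ (comp y) γ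
    term-cut : ∀ y₁ y₂ → term (y₁ ++ true ∷ y₂) ≡ ∑deconcat γ (λ γ₁ γ₂ → (τ y₁ * δ (comp y₁) γ₁) * (τ y₂ * δ (comp y₂) γ₂))
    term-cut y₁ y₂ =
      trans (cong₂ _*_ (τ-cut-++ y₁ y₂) (trans (cong (λ z → δ z γ) (comp-cut-++ y₁ y₂)) (sym (∑deconcat-δ-δ (comp y₁) (comp y₂) γ))))
      (trans (sym (∑-*ˡ (τ y₁ * τ y₂) (deconcat γ) _))
             (∑deconcat-cong γ (λ γ₁ γ₂ → solve 4 (λ a b c d → (a :* b) :* (c :* d) := (a :* c) :* (b :* d)) refl
                                                  (τ y₁) (τ y₂) (δ (comp y₁) γ₁) (δ (comp y₂) γ₂))))

  pairing-*N-M : ∀ x y γ → pairing p (x *N y) (M γ) ≡ ∑deconcat γ (λ γ₁ γ₂ → pairing p x (M γ₁) * pairing p y (M γ₂))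
  pairing-*N-M x y γ =
    trans (pairing-M p (x *N y) γ)
    (trans (eval-*N (λ w → p w γ) x y)
    (trans (eval-cong x (λ u → eval-cong y (λ v → p-++ u v γ)))
    (trans (∑-cong x (λ c,u → trans (sym (∑-*ˡ (proj₁ c,u) y _)) (∑-cong y (λ d,v → rearrange c,u d,v))))
    (trans (∑-∑-deconcat x y γ (λ c,u γ₁ → proj₁ c,u * p (proj₂ c,u) γ₁) (λ d,v γ₂ → proj₁ d,v * p (proj₂ d,v) γ₂))
           (∑deconcat-cong γ (λ γ₁ γ₂ → sym (cong₂ _*_ (pairing-M p x γ₁) (pairing-M p y γ₂))))))))
    where
    rearrange : ∀ (c,u d,v : ℚ × Comp) →
                proj₁ c,u * (proj₁ d,v * ∑deconcat γ (λ γ₁ γ₂ → p (proj₂ c,u) γ₁ * p (proj₂ d,v) γ₂))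
                ≡ ∑deconcat γ (λ γ₁ γ₂ → (proj₁ c,u * p (proj₂ c,u) γ₁) * (proj₁ d,v * p (proj₂ d,v) γ₂))
    rearrange (c , u) (d , v) =
      trans (sym (ℚP.*-assoc c d _))
      (trans (sym (∑-*ˡ (c * d) (deconcat γ) _))
             (∑deconcat-cong γ (λ γ₁ γ₂ → solve 4 (λ a b x y → (a :* b) :* (x :* y) := (a :* x) :* (b :* y)) refl c d (p u γ₁) (p v γ₂))))

module Coproducts where

  open Sums
  open LinearFunctionals
  open NSymAlgebra
  open QuasiShuffles
  open Antidiagonals

  eval-*Q-M : ∀ φ f γ → eval φ (f *Q M γ) ≡ eval (λ α → ∑qsh α γ φ) f
  eval-*Q-M φ [] γ = refl
  eval-*Q-M φ ((c , α) ∷ f) γ =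
    trans (eval-++ φ (map (λ ζ → (c * 1ℚ , ζ)) (qsh α γ) ++ []) (f *Q M γ))
          (cong₂ _+_ (trans (eval-++ φ (map (λ ζ → (c * 1ℚ , ζ)) (qsh α γ)) [])
                     (trans (ℚP.+-identityʳ _)
                     (trans (∑-map _ (qsh α γ) _)
                     (trans (∑-cong (qsh α γ) (λ ζ → cong (_* φ ζ) (ℚP.*-identityʳ c)))
                            (∑-*ˡ c (qsh α γ) φ)))))
                     (eval-*Q-M φ f γ))

  refinements-ones : ∀ i → refinements (ones i) ≡ ones i ∷ []
  refinements-ones zero = refl
  refinements-ones (suc i) rewrite refinements-ones i = refl

  F-ones≡M : ∀ i → F (ones i) ≡ M (ones i)
  F-ones≡M i rewrite refinements-ones i = refl

  eval-F-ones-*Q : ∀ φ i γ → eval φ (F (ones i) *Q M γ) ≡ ∑qsh (ones i) γ φ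
  eval-F-ones-*Q φ i γ rewrite F-ones≡M i =
    trans (eval-*Q-M φ (M (ones i)) γ) (eval-singleton (λ α → ∑qsh α γ φ) (ones i))

  eval-F-row-*Q : ∀ φ i γ → eval φ (F (row i) *Q M γ) ≡ ∑ (compositionsOf i) (λ β → ∑qsh β γ φ)
  eval-F-row-*Q φ i γ =
    trans (eval-*Q-M φ (F (row i)) γ)
          (trans (∑-map _ (compositionsOf i) _) (∑-cong (compositionsOf i) (λ β → ℚP.*-identityˡ _)))

  -- Δ G_i = Σ_{a+b=i} G_a ⊗ G_b, stated through the action of G_i on the monomial basis.
  DividedPowers : (ℕ → QSym) → Set
  DividedPowers G =
    ∀ i γ (Φ : Comp → Comp → ℚ) →
    eval (λ ζ → ∑deconcat ζ Φ) (G i *Q M γ)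
    ≡ ∑ (antidiagonal i) (λ s → ∑deconcat γ (λ γ₁ γ₂ →
        eval (λ ζ₁ → eval (λ ζ₂ → Φ ζ₁ ζ₂) (G (proj₂ s) *Q M γ₂)) (G (proj₁ s) *Q M γ₁)))

  dividedPowers-ones : DividedPowers (λ i → F (ones i))
  dividedPowers-ones i γ Φ =
    trans (eval-F-ones-*Q _ i γ)
    (trans (∑qsh-deconcat (ones i) γ Φ)
    (trans (∑deconcat-ones i _)
           (∑-cong (antidiagonal i) (λ s → ∑deconcat-cong γ (λ γ₁ γ₂ →
              sym (trans (eval-F-ones-*Q _ (proj₁ s) γ₁)
                         (∑qsh-cong (ones (proj₁ s)) γ₁ (λ ζ₁ → eval-F-ones-*Q (Φ ζ₁) (proj₂ s) γ₂))))))))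

  dividedPowers-row : DividedPowers (λ i → F (row i))
  dividedPowers-row i γ Φ =
    trans (eval-F-row-*Q _ i γ)
    (trans (∑-cong (compositionsOf i) (λ β → ∑qsh-deconcat β γ Φ))
    (trans (∑-compositionsOf-deconcat i _)
           (∑-cong (antidiagonal i) (λ s →
              trans (∑-cong (compositionsOf (proj₁ s)) (λ β₁ → ∑-swap (compositionsOf (proj₂ s)) (deconcat γ) _))
              (trans (∑-swap (compositionsOf (proj₁ s)) (deconcat γ) _)
                     (∑deconcat-cong γ (λ γ₁ γ₂ →
                        trans (∑-cong (compositionsOf (proj₁ s)) (λ β₁ → ∑-swap (compositionsOf (proj₂ s)) (qsh β₁ γ₁) _))
                              (sym (trans (eval-F-row-*Q _ (proj₁ s) γ₁)
                                          (∑-cong (compositionsOf (proj₁ s)) (λ β₁ →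
                                             ∑qsh-cong β₁ γ₁ (λ ζ₁ → eval-F-row-*Q (Φ ζ₁) (proj₂ s) γ₂))))))))))))

record IsLinear (O : NSym → NSym) : Set where
  field
    resp-≈ : ∀ {a b} → a ≈ b → O a ≈ O b
    +N-homo : ∀ a b → O (a +N b) ≈ O a +N O b
    scaleN-homo : ∀ c a → O (scaleN c a) ≈ scaleN c (O a)

module LinearOperators where

  open LinearFunctionals
  open NSymAlgebra
  open Relation.Binary.Reasoning.Setoid ≈-setoid

  module _ {O : NSym → NSym} (O-linear : IsLinear O) where

    open IsLinear O-linear

    zeroN-homo : O zeroN ≈ zeroN
    zeroN-homo w = x≡x+x⇒x≡0 (trans (+N-homo zeroN zeroN w) (coeff-++ w (O zeroN) (O zeroN)))
      where
      x≡x+x⇒x≡0 : ∀ {x : ℚ} → x ≡ x + x → x ≡ 0ℚ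
      x≡x+x⇒x≡0 {x} x≡x+x =
        trans (solve 1 (λ y → y := (y :+ y) :+ (:- y)) refl x) (trans (cong (_+ (- x)) (sym x≡x+x)) (ℚP.+-inverseʳ x))

    linear-sumN : ∀ {A : Set} (xs : List A) (f : A → NSym) → O (sumN (map f xs)) ≈ sumN (map (λ x → O (f x)) xs)
    linear-sumN [] f = zeroN-homo
    linear-sumN (x ∷ xs) f = begin
      O (f x +N sumN (map f xs))         ≈⟨ +N-homo (f x) (sumN (map f xs)) ⟩
      O (f x) +N O (sumN (map f xs))     ≈⟨ +N-cong {O (f x)} {O (f x)} (λ _ → refl) (linear-sumN xs f) ⟩
      O (f x) +N sumN (map (λ x → O (f x)) xs) ∎

    linear-expand : ∀ a → O a ≈ sumN (map (λ y → scaleN (proj₁ y) (O (word (proj₂ y)))) a)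
    linear-expand [] = zeroN-homo
    linear-expand ((c , w) ∷ a) = begin
      O (((c , w) ∷ []) ++ a)                  ≈⟨ +N-homo ((c , w) ∷ []) a ⟩
      O ((c , w) ∷ []) +N O a                  ≈⟨ +N-cong {O ((c , w) ∷ [])} {scaleN c (O (word w))} {O a} monomial (linear-expand a) ⟩
      scaleN c (O (word w)) +N sumN (map (λ y → scaleN (proj₁ y) (O (word (proj₂ y)))) a) ∎
      where
      monomial : O ((c , w) ∷ []) ≈ scaleN c (O (word w))
      monomial v =
        trans (resp-≈ {(c , w) ∷ []} {scaleN c (word w)} (λ v′ → cong (λ z → coeff v′ ((z , w) ∷ [])) (sym (ℚP.*-identityʳ c))) v)
              (scaleN-homo c (word w) v)

  ∘-isLinear : ∀ {O O′} → IsLinear O → IsLinear O′ → IsLinear (λ x → O (O′ x))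
  ∘-isLinear {O} {O′} O-linear O′-linear = record
    { resp-≈ = λ {a} {b} a≈b → O.resp-≈ {O′ a} {O′ b} (O′.resp-≈ {a} {b} a≈b)
    ; +N-homo = λ a b w → trans (O.resp-≈ {O′ (a +N b)} {O′ a +N O′ b} (O′.+N-homo a b) w) (O.+N-homo (O′ a) (O′ b) w)
    ; scaleN-homo = λ c a w → trans (O.resp-≈ {O′ (scaleN c a)} {scaleN c (O′ a)} (O′.scaleN-homo c a) w) (O.scaleN-homo c (O′ a) w)
    }
    where
    module O = IsLinear O-linear
    module O′ = IsLinear O′-linear

module Skewing (p : Comp → Comp → ℚ) (dual : IsDualPairing p) (perp : QSym → NSym → NSym) (isPerp : IsPerp p perp) where

  open Sums
  open LinearFunctionals
  open NSymAlgebra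
  open QuasiShuffles
  open Antidiagonals
  open Coproducts
  open Duality p dual

  pairing-perp-M : ∀ f a γ → pairing p (perp f a) (M γ) ≡ eval (λ ζ → pairing p a (M ζ)) (f *Q M γ)
  pairing-perp-M f a γ = trans (isPerp f a (M γ)) (pairing-expand-M p a (f *Q M γ))

  perp-isLinear : ∀ f → IsLinear (perp f)
  perp-isLinear f = record
    { resp-≈ = λ {a} {b} a≈b → ≈-from-pairing-M {perp f a} {perp f b} (λ γ →
        trans (pairing-perp-M f a γ)
        (trans (eval-cong (f *Q M γ) (λ ζ → pairing-respˡ p {a} {b} (M ζ) a≈b))
               (sym (pairing-perp-M f b γ))))
    ; +N-homo = λ a b → ≈-from-pairing-M {perp f (a +N b)} {perp f a +N perp f b} (λ γ →
        trans (pairing-perp-M f (a ++ b) γ)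
        (trans (eval-cong (f *Q M γ) (λ ζ → pairing-++ˡ p a b (M ζ)))
        (trans (eval-+ _ _ (f *Q M γ))
               (sym (trans (pairing-++ˡ p (perp f a) (perp f b) (M γ))
                           (cong₂ _+_ (pairing-perp-M f a γ) (pairing-perp-M f b γ)))))))
    ; scaleN-homo = λ k a → ≈-from-pairing-M {perp f (scaleN k a)} {scaleN k (perp f a)} (λ γ →
        trans (pairing-perp-M f (scaleN k a) γ)
        (trans (eval-cong (f *Q M γ) (λ ζ → pairing-scaleNˡ p k a (M ζ)))
        (trans (eval-*ˡ k _ (f *Q M γ))
               (sym (trans (pairing-scaleNˡ p k (perp f a) (M γ)) (cong (k *_) (pairing-perp-M f a γ)))))))
    }

  perp-resp : ∀ f {a b} → a ≈ b → perp f a ≈ perp f b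
  perp-resp f = IsLinear.resp-≈ (perp-isLinear f)

  perp-*N : ∀ (G : ℕ → QSym) → DividedPowers G → ∀ i x y →
            perp (G i) (x *N y) ≈ sumN (map (λ s → perp (G (proj₁ s)) x *N perp (G (proj₂ s)) y) (antidiagonal i))
  perp-*N G ΔG i x y = ≈-from-pairing-M {perp (G i) (x *N y)} {sumN (map term (antidiagonal i))} (λ γ →
    trans (pairing-perp-M (G i) (x *N y) γ)
    (trans (eval-cong (G i *Q M γ) (λ ζ → pairing-*N-M x y ζ))
    (trans (ΔG i γ (λ ζ₁ ζ₂ → pairing p x (M ζ₁) * pairing p y (M ζ₂)))
    (trans (∑-cong (antidiagonal i) (λ s →
              trans (∑deconcat-cong γ (λ γ₁ γ₂ →
                       trans (eval-eval-* (G (proj₁ s) *Q M γ₁) (G (proj₂ s) *Q M γ₂) (λ ζ → pairing p x (M ζ)) (λ ζ → pairing p y (M ζ)))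
                             (sym (cong₂ _*_ (pairing-perp-M (G (proj₁ s)) x γ₁) (pairing-perp-M (G (proj₂ s)) y γ₂)))))
                    (sym (pairing-*N-M (perp (G (proj₁ s)) x) (perp (G (proj₂ s)) y) γ))))
           (sym (trans (pairing-sumNˡ p (map term (antidiagonal i)) (M γ))
                       (∑-map term (antidiagonal i) (λ a → pairing p a (M γ)))))))))
    where
    term : ℕ × ℕ → NSym
    term s = perp (G (proj₁ s)) x *N perp (G (proj₂ s)) y

  perpOnes perpRow : ℕ → NSym → NSym
  perpOnes i = perp (F (ones i))
  perpRow i = perp (F (row i))

  perpOnes-*N : ∀ i x y → perpOnes i (x *N y) ≈ sumN (map (λ s → perpOnes (proj₁ s) x *N perpOnes (proj₂ s) y) (antidiagonal i))
  perpOnes-*N = perp-*N (λ i → F (ones i)) dividedPowers-ones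

  perpRow-*N : ∀ i x y → perpRow i (x *N y) ≈ sumN (map (λ s → perpRow (proj₁ s) x *N perpRow (proj₂ s) y) (antidiagonal i))
  perpRow-*N = perp-*N (λ i → F (row i)) dividedPowers-row

module Generators (p : Comp → Comp → ℚ) (dual : IsDualPairing p) (perp : QSym → NSym → NSym) (isPerp : IsPerp p perp) where

  open import Data.Integer using (+_; _⊖_)
  open Sums
  open SignsAndDeltas
  open LinearFunctionals
  open NSymAlgebra
  open CutVectors
  open CutSigns
  open QuasiShuffles
  open Antidiagonals
  open Coproducts
  open Duality p dual
  open Skewing p dual perp isPerp

  size-ones : ∀ j → size (ones j) ≡ j
  size-ones zero = refl
  size-ones (suc j) = cong suc (size-ones j)

  sgn-size∸length : ∀ ζ → sgn (size ζ ℕ.∸ length ζ) ≡ sgn (size ζ) * sgn (length ζ)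
  sgn-size∸length ζ = sgn-∸ (size ζ) (length ζ) (length≤size ζ)

  e-negative : ∀ m → 0 < m → e (ℤ.- (+ m)) ≡ zeroN
  e-negative (suc m) _ = refl

  h-negative : ∀ m → 0 < m → h (ℤ.- (+ m)) ≡ zeroN
  h-negative (suc m) _ = refl

  pairing-oneN-M : ∀ ζ → pairing p oneN (M ζ) ≡ δ [] ζ
  pairing-oneN-M ζ = trans (pairing-M p oneN ζ) (trans (eval-singleton (λ w → p w ζ) []) (p≡pairingEM [] ζ))

  pairing-e-M : ∀ n ζ → pairing p (e (+ n)) (M ζ) ≡ δN (size ζ) n * sgn (size ζ ℕ.∸ length ζ)
  pairing-e-M zero [] = pairing-oneN-M []
  pairing-e-M zero (a ∷ ζ) = trans (pairing-oneN-M (a ∷ ζ)) (sym (ℚP.*-zeroˡ (sgn (size (a ∷ ζ) ℕ.∸ length (a ∷ ζ)))))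
  pairing-e-M (suc k) ζ =
    trans (pairing-M p (e (+ suc k)) ζ)
    (trans (eval-singleton (λ w → p w ζ) (k ∷ []))
    (trans (p≡pairingEM (k ∷ []) ζ) (by-shape ζ)))
    where
    via-cuts : ∀ x → ∑ (vectors k) (λ y → τ y * δ (comp y) (comp x)) ≡ δN (size (comp x)) (suc k) * sgn (size (comp x) ℕ.∸ length (comp x))
    via-cuts x =
      trans (∑-cong (vectors k) (λ y → trans (cong (τ y *_) (δ-comp y x)) (ℚP.*-comm (τ y) (δv y x))))
      (trans (∑-vectors-δv k x τ)
      (sym (trans (cong₂ (λ a b → δN a (suc k) * sgn (a ℕ.∸ b)) (size-comp x) (length-comp x))
           (cong₂ _*_ (δN-suc (length x) k)
                      (cong sgn (trans (cong (ℕ._∸ ncut x) (sym (ncut+njoin x))) (ℕP.m+n∸m≡n (ncut x) (njoin x))))))))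
    by-shape : ∀ ζ → ∑ (vectors k) (λ y → τ y * δ (comp y) ζ) ≡ δN (size ζ) (suc k) * sgn (size ζ ℕ.∸ length ζ)
    by-shape [] = trans (∑-vanish (vectors k) (λ y → ℚP.*-zeroʳ (τ y))) (sym (ℚP.*-zeroˡ 1ℚ))
    by-shape (a ∷ α) =
      subst (λ z → ∑ (vectors k) (λ y → τ y * δ (comp y) z) ≡ δN (size z) (suc k) * sgn (size z ℕ.∸ length z))
            (comp-cuts a α) (via-cuts (cuts a α))

  pairing-e-⊖-M : ∀ n j γ → pairing p (e (n ⊖ j)) (M γ) ≡ δN (j ℕ.+ size γ) n * (sgn (j ℕ.+ size γ) * sgn (j ℕ.+ length γ))
  pairing-e-⊖-M n j γ with j ℕ.≤? n
  ... | yes j≤n =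
    trans (cong (λ z → pairing p (e z) (M γ)) (ℤP.⊖-≥ j≤n))
    (trans (pairing-e-M (n ℕ.∸ j) γ)
    (sym (cong₂ _*_ (δN-∸ j (size γ) n j≤n) (begin
      sgn (j ℕ.+ size γ) * sgn (j ℕ.+ length γ)           ≡⟨ cong₂ _*_ (sgn-+ j (size γ)) (sgn-+ j (length γ)) ⟩
      (sgn j * sgn (size γ)) * (sgn j * sgn (length γ))   ≡⟨ solve 3 (λ a b c → (a :* b) :* (a :* c) := (a :* a) :* (b :* c)) refl (sgn j) _ _ ⟩
      (sgn j * sgn j) * (sgn (size γ) * sgn (length γ))   ≡⟨ cong (_* (sgn (size γ) * sgn (length γ))) (sgn-square j) ⟩
      1ℚ * (sgn (size γ) * sgn (length γ))                ≡⟨ ℚP.*-identityˡ _ ⟩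
      sgn (size γ) * sgn (length γ)                       ≡⟨ sgn-size∸length γ ⟨
      sgn (size γ ℕ.∸ length γ)                           ∎))))
    where open ≡-Reasoning
  ... | no j≰n =
    trans (cong (λ z → pairing p (e z) (M γ)) (ℤP.⊖-≰ j≰n))
    (trans (cong (λ z → pairing p z (M γ)) (e-negative (j ℕ.∸ n) (ℕP.m<n⇒0<n∸m (ℕP.≰⇒> j≰n))))
    (sym (trans (cong (_* (sgn (j ℕ.+ size γ) * sgn (j ℕ.+ length γ)))
                      (δN-≢ (λ j+size≡n → j≰n (ℕP.≤-trans (ℕP.m≤m+n j (size γ)) (ℕP.≤-reflexive j+size≡n)))))
                (ℚP.*-zeroˡ (sgn (j ℕ.+ size γ) * sgn (j ℕ.+ length γ))))))

  perpOnes-e : ∀ n j → perpOnes j (e (+ n)) ≈ e (n ⊖ j)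
  perpOnes-e n j = ≈-from-pairing-M {perpOnes j (e (+ n))} {e (n ⊖ j)} (λ γ → begin
    pairing p (perpOnes j (e (+ n))) (M γ)
      ≡⟨ pairing-perp-M (F (ones j)) (e (+ n)) γ ⟩
    eval (λ ζ → pairing p (e (+ n)) (M ζ)) (F (ones j) *Q M γ)
      ≡⟨ eval-F-ones-*Q _ j γ ⟩
    ∑qsh (ones j) γ (λ ζ → pairing p (e (+ n)) (M ζ))
      ≡⟨ ∑qsh-cong (ones j) γ (pairing-e-M n) ⟩
    ∑qsh (ones j) γ (λ ζ → δN (size ζ) n * sgn (size ζ ℕ.∸ length ζ))
      ≡⟨ ∑qsh-cong-size (ones j) γ (λ ζ size≡ → factor-sign γ ζ (size-ζ {ζ} {γ} size≡)) ⟩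
    ∑qsh (ones j) γ (λ ζ → (δN (j ℕ.+ size γ) n * sgn (j ℕ.+ size γ)) * sgn (length ζ))
      ≡⟨ ∑-*ˡ (δN (j ℕ.+ size γ) n * sgn (j ℕ.+ size γ)) (qsh (ones j) γ) (λ ζ → sgn (length ζ)) ⟩
    (δN (j ℕ.+ size γ) n * sgn (j ℕ.+ size γ)) * ∑qsh (ones j) γ (λ ζ → sgn (length ζ))
      ≡⟨ cong (δN (j ℕ.+ size γ) n * sgn (j ℕ.+ size γ) *_)
              (trans (∑qsh-sgn-length (ones j) γ) (cong (λ a → sgn (a ℕ.+ length γ)) (length-replicate j))) ⟩
    (δN (j ℕ.+ size γ) n * sgn (j ℕ.+ size γ)) * sgn (j ℕ.+ length γ)
      ≡⟨ ℚP.*-assoc (δN (j ℕ.+ size γ) n) (sgn (j ℕ.+ size γ)) (sgn (j ℕ.+ length γ)) ⟩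
    δN (j ℕ.+ size γ) n * (sgn (j ℕ.+ size γ) * sgn (j ℕ.+ length γ))
      ≡⟨ pairing-e-⊖-M n j γ ⟨
    pairing p (e (n ⊖ j)) (M γ)     ∎)
    where
    open ≡-Reasoning
    size-ζ : ∀ {ζ γ} → size ζ ≡ size (ones j) ℕ.+ size γ → size ζ ≡ j ℕ.+ size γ
    size-ζ {γ = γ} size≡ = trans size≡ (cong (ℕ._+ size γ) (size-ones j))
    factor-sign : ∀ γ ζ → size ζ ≡ j ℕ.+ size γ →
                  δN (size ζ) n * sgn (size ζ ℕ.∸ length ζ) ≡ (δN (j ℕ.+ size γ) n * sgn (j ℕ.+ size γ)) * sgn (length ζ)
    factor-sign γ ζ size≡ =
      trans (cong (δN (size ζ) n *_) (sgn-size∸length ζ))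
      (trans (sym (ℚP.*-assoc (δN (size ζ) n) (sgn (size ζ)) (sgn (length ζ))))
             (cong (λ a → (δN a n * sgn a) * sgn (length ζ)) size≡))

  pairing-h-M : ∀ n ζ → pairing p (h (+ n)) (M ζ) ≡ δ (row n) ζ
  pairing-h-M zero ζ = pairing-oneN-M ζ
  pairing-h-M (suc k) ζ =
    trans (pairing-respˡ p {h (+ suc k)} {hComp (k ∷ [])} (M ζ) (λ w → sym (*N-identityʳ (h (+ suc k)) w)))
          (pairing-hComp-M (k ∷ []) ζ)

  pairing-h-⊖-M-[] : ∀ k i → pairing p (h (k ⊖ i)) (M []) ≡ δN k i
  pairing-h-⊖-M-[] k i with i ℕ.≤? k
  ... | yes i≤k =
    trans (cong (λ z → pairing p (h z) (M [])) (ℤP.⊖-≥ i≤k))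
    (trans (pairing-h-M (k ℕ.∸ i) [])
    (trans (δ-row-[] (k ℕ.∸ i))
    (trans (sym (δN-+ˡ i (k ℕ.∸ i) 0)) (cong₂ δN (ℕP.m+[n∸m]≡n i≤k) (ℕP.+-identityʳ i)))))
    where
    δ-row-[] : ∀ d → δ (row d) [] ≡ δN d 0
    δ-row-[] zero = refl
    δ-row-[] (suc d) = refl
  ... | no i≰k =
    trans (cong (λ z → pairing p (h z) (M [])) (ℤP.⊖-≰ i≰k))
    (trans (cong (λ z → pairing p z (M [])) (h-negative (i ℕ.∸ k) (ℕP.m<n⇒0<n∸m (ℕP.≰⇒> i≰k))))
           (sym (δN-≢ (λ k≡i → i≰k (ℕP.≤-reflexive (sym k≡i))))))

  pairing-h-⊖-M-∷ : ∀ k i b v → pairing p (h (k ⊖ i)) (M (b ∷ v)) ≡ δN k (suc (i ℕ.+ b)) * δ [] v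
  pairing-h-⊖-M-∷ k i b v with i ℕ.≤? k
  ... | yes i≤k =
    trans (cong (λ z → pairing p (h z) (M (b ∷ v))) (ℤP.⊖-≥ i≤k))
    (trans (pairing-h-M (k ℕ.∸ i) (b ∷ v))
    (trans (sym (by-length (k ℕ.∸ i)))
           (cong (λ z → δN z (suc (i ℕ.+ b)) * δ [] v) (ℕP.m+[n∸m]≡n i≤k))))
    where
    by-length : ∀ d → δN (i ℕ.+ d) (suc (i ℕ.+ b)) * δ [] v ≡ δ (row d) (b ∷ v)
    by-length zero =
      trans (cong (_* δ [] v) (δN-≢ (λ i+0≡ → ℕP.<-irrefl i+0≡ (s≤s (ℕP.≤-trans (ℕP.≤-reflexive (ℕP.+-identityʳ i)) (ℕP.m≤m+n i b))))))
            (ℚP.*-zeroˡ (δ [] v))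
    by-length (suc d) =
      trans (cong (_* δ [] v) (trans (cong (λ z → δN z (suc (i ℕ.+ b))) (ℕP.+-suc i d))
                              (trans (δN-suc (i ℕ.+ d) (i ℕ.+ b)) (δN-+ˡ i d b))))
            (sym (δ-∷ d [] b v))
  ... | no i≰k =
    trans (cong (λ z → pairing p (h z) (M (b ∷ v))) (ℤP.⊖-≰ i≰k))
    (trans (cong (λ z → pairing p z (M (b ∷ v))) (h-negative (i ℕ.∸ k) (ℕP.m<n⇒0<n∸m (ℕP.≰⇒> i≰k))))
    (sym (trans (cong (_* δ [] v) (δN-≢ (λ k≡ → i≰k (ℕP.≤-trans (ℕP.m≤m+n i b) (ℕP.≤-trans (ℕP.n≤1+n (i ℕ.+ b)) (ℕP.≤-reflexive (sym k≡)))))))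
                (ℚP.*-zeroˡ (δ [] v)))))

  ∑qsh-δ[] : ∀ u v → ∑qsh u v (δ []) ≡ δ [] u * δ [] v
  ∑qsh-δ[] [] v = solve 1 (λ x → x :+ con 0ℚ := con 1ℚ :* x) refl (δ [] v)
  ∑qsh-δ[] (a ∷ u) [] = refl
  ∑qsh-δ[] (a ∷ u) (b ∷ v) =
    trans (∑qsh-∷-∷ a u b v (δ []))
          (cong₂ _+_ (∑-zero (qsh u (b ∷ v))) (cong₂ _+_ (∑-zero (qsh (a ∷ u) v)) (∑-zero (qsh u v))))

  ∑qsh-δ-single-∷ : ∀ k a u b v → ∑qsh (a ∷ u) (b ∷ v) (δ (k ∷ [])) ≡ δ [] u * (δN k (suc (a ℕ.+ b)) * δ [] v)
  ∑qsh-δ-single-∷ k a u b v =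
    trans (∑qsh-∷-∷ a u b v (δ (k ∷ [])))
    (trans (cong₂ _+_ (trans (head a u (b ∷ v)) (*-vanishʳ (δN k a) (ℚP.*-zeroʳ (δ [] u))))
                      (cong₂ _+_ (trans (head b (a ∷ u) v) (*-vanishʳ (δN k b) (ℚP.*-zeroˡ (δ [] v)))) (head (suc (a ℕ.+ b)) u v)))
           (solve 3 (λ x t w → con 0ℚ :+ (con 0ℚ :+ x :* (t :* w)) := t :* (x :* w)) refl (δN k (suc (a ℕ.+ b))) (δ [] u) (δ [] v)))
    where
    head : ∀ x u w → ∑qsh u w (λ ζ → δ (k ∷ []) (x ∷ ζ)) ≡ δN k x * (δ [] u * δ [] w)
    head x u w =
      trans (∑qsh-cong u w (λ ζ → δ-∷ k [] x ζ))
            (trans (∑-*ˡ (δN k x) (qsh u w) (δ [])) (cong (δN k x *_) (∑qsh-δ[] u w)))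

  ∑-compositionsOf-qsh-δ-row : ∀ n j γ → ∑ (compositionsOf j) (λ β → ∑qsh β γ (δ (row n))) ≡ pairing p (h (n ⊖ j)) (M γ)
  ∑-compositionsOf-qsh-δ-row n zero γ =
    trans (ℚP.+-identityʳ _)
    (trans (ℚP.+-identityʳ _)
    (trans (sym (pairing-h-M n γ)) (cong (λ z → pairing p (h z) (M γ)) (sym (ℤP.⊖-≥ {n} {0} z≤n)))))
  ∑-compositionsOf-qsh-δ-row zero (suc i) γ =
    trans (∑-compositionsOf-suc i _)
          (∑-vanish (vectors i) (λ y → trans (∑qsh-δ[] (comp y) γ) (ℚP.*-zeroˡ (δ [] γ))))
  ∑-compositionsOf-qsh-δ-row (suc k) (suc i) [] =
    trans (∑-compositionsOf-suc i _)
    (trans (∑-cong (vectors i) single)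
    (trans (∑-vectors-δv i (noCuts k) (λ _ → 1ℚ))
    (trans (cong (λ z → δN z i * 1ℚ) (length-replicate k))
    (trans (ℚP.*-identityʳ _)
    (trans (sym (pairing-h-⊖-M-[] k i)) (cong (λ z → pairing p (h z) (M [])) (sym (ℤP.[1+m]⊖[1+n]≡m⊖n k i))))))))
    where
    single : ∀ y → ∑qsh (comp y) [] (δ (k ∷ [])) ≡ δv y (noCuts k) * 1ℚ
    single y =
      trans (∑qsh-[]ʳ (comp y) (δ (k ∷ [])))
      (trans (ℚP.+-identityʳ (δ (k ∷ []) (comp y)))
      (trans (δ-sym (k ∷ []) (comp y))
      (trans (cong (δ (comp y)) (sym (comp-cuts k [])))
             (trans (δ-comp y (noCuts k)) (sym (ℚP.*-identityʳ _))))))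
  ∑-compositionsOf-qsh-δ-row (suc k) (suc i) (b ∷ v) =
    trans (∑-compositionsOf-suc i _)
    (trans (∑-cong (vectors i) (λ y → ∑qsh-δ-single-∷ k (proj₁ (comp′ y)) (proj₂ (comp′ y)) b v))
    (trans (∑-cong (vectors i) (λ y → no-cut y f))
    (trans (∑-vectors-cong i (λ y length≡i → cong (λ z → δv y (noCuts z) * f z) length≡i))
    (trans (∑-vectors-δv i (noCuts i) (λ _ → f i))
    (trans (cong (λ z → δN z i * f i) (length-replicate i))
    (trans (cong (_* f i) (δN-refl i))
    (trans (ℚP.*-identityˡ _)
    (trans (sym (pairing-h-⊖-M-∷ k i b v)) (cong (λ z → pairing p (h z) (M (b ∷ v))) (sym (ℤP.[1+m]⊖[1+n]≡m⊖n k i)))))))))))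
    where
    f : ℕ → ℚ
    f x = δN k (suc (x ℕ.+ b)) * δ [] v
    no-cut : ∀ y (g : ℕ → ℚ) → δ [] (proj₂ (comp′ y)) * g (proj₁ (comp′ y)) ≡ δv y (noCuts (length y)) * g (length y)
    no-cut [] g = refl
    no-cut (true ∷ y) g = trans (ℚP.*-zeroˡ (g 0)) (sym (ℚP.*-zeroˡ (g (suc (length y)))))
    no-cut (false ∷ y) g = no-cut y (λ x → g (suc x))

  perpRow-h : ∀ n j → perpRow j (h (+ n)) ≈ h (n ⊖ j)
  perpRow-h n j = ≈-from-pairing-M {perpRow j (h (+ n))} {h (n ⊖ j)} (λ γ →
    trans (pairing-perp-M (F (row j)) (h (+ n)) γ)
    (trans (eval-F-row-*Q _ j γ)
    (trans (∑-cong (compositionsOf j) (λ β → ∑qsh-cong β γ (pairing-h-M n)))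
           (∑-compositionsOf-qsh-δ-row n j γ))))

  eval-vanish-≤deg : ∀ φ x → (∀ w → size w ≤ deg x → φ w ≡ 0ℚ) → eval φ x ≡ 0ℚ
  eval-vanish-≤deg φ [] _ = refl
  eval-vanish-≤deg φ ((c , w) ∷ x) vanish =
    trans (cong₂ _+_ (*-vanishʳ c (vanish w (ℕP.m≤m⊔n (size w) (deg x))))
                     (eval-vanish-≤deg φ x (λ w′ w′≤ → vanish w′ (ℕP.≤-trans w′≤ (ℕP.m≤n⊔m (size w) (deg x))))))
          (ℚP.+-identityˡ 0ℚ)

  pairing-M-beyond-deg : ∀ x ζ → deg x < size ζ → pairing p x (M ζ) ≡ 0ℚ
  pairing-M-beyond-deg x ζ deg<size =
    trans (pairing-M p x ζ)
          (eval-vanish-≤deg (λ w → p w ζ) x (λ w w≤deg → p-size-mismatch w ζ (λ w≡ζ →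
             ℕP.<-irrefl refl (ℕP.≤-<-trans (ℕP.≤-trans (ℕP.≤-reflexive (sym w≡ζ)) w≤deg) deg<size))))

  perpOnes-beyond-deg : ∀ i x → deg x < i → perpOnes i x ≈ zeroN
  perpOnes-beyond-deg i x deg<i = ≈-from-pairing-M {perpOnes i x} {zeroN} (λ γ →
    trans (pairing-perp-M (F (ones i)) x γ)
    (trans (eval-F-ones-*Q _ i γ)
    (trans (∑qsh-cong-size (ones i) γ {g = λ _ → 0ℚ} (λ ζ size≡ → pairing-M-beyond-deg x ζ (begin-strict
              deg x                       <⟨ deg<i ⟩
              i                           ≤⟨ ℕP.m≤m+n i (size γ) ⟩
              i ℕ.+ size γ                ≡⟨ cong (ℕ._+ size γ) (size-ones i) ⟨
              size (ones i) ℕ.+ size γ    ≡⟨ size≡ ⟨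
              size ζ                      ∎)))
           (∑-zero (qsh (ones i) γ)))))
    where open ℕP.≤-Reasoning

  perpRow-beyond-deg : ∀ i x → deg x < i → perpRow i x ≈ zeroN
  perpRow-beyond-deg (suc m) x deg<1+m = ≈-from-pairing-M {perpRow (suc m) x} {zeroN} (λ γ →
    trans (pairing-perp-M (F (row (suc m))) x γ)
    (trans (eval-F-row-*Q _ (suc m) γ)
    (trans (∑-compositionsOf-suc m _)
    (trans (∑-vectors-cong m {g = λ _ → 0ℚ} (λ y length≡m →
              trans (∑qsh-cong-size (comp y) γ {g = λ _ → 0ℚ} (λ ζ size≡ → pairing-M-beyond-deg x ζ (begin-strict
                       deg x                          <⟨ deg<1+m ⟩
                       suc m                          ≡⟨ cong suc length≡m ⟨
                       suc (length y)                 ≡⟨ size-comp y ⟨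
                       size (comp y)                  ≤⟨ ℕP.m≤m+n (size (comp y)) (size γ) ⟩
                       size (comp y) ℕ.+ size γ       ≡⟨ size≡ ⟨
                       size ζ                         ∎)))
                    (∑-zero (qsh (comp y) γ))))
           (∑-zero (vectors m))))))
    where open ℕP.≤-Reasoning

  signedHComps : ℕ → NSym
  signedHComps k = sumN (map (λ β → scaleN (sgn (suc k ℕ.∸ length β)) (hComp β)) (comps (suc k)))

  -- The defining expansion of h in the e's, with the roles of e and h exchanged.
  e≈signedHComps : ∀ k → e (+ suc k) ≈ signedHComps k
  e≈signedHComps k = ≈-from-pairing-M {e (+ suc k)} {signedHComps k} (λ γ →
    trans (pairing-M p (e (+ suc k)) γ)
    (trans (eval-singleton (λ w → p w γ) (k ∷ []))
    (trans (p≡pairingEM (k ∷ []) γ) (sym (pairing-signedHComps γ)))))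
    where
    pairing-signedHComps : ∀ γ → pairing p (signedHComps k) (M γ) ≡ ∑ (vectors k) (λ y → τ y * δ (comp y) γ)
    pairing-signedHComps γ =
      trans (pairing-sumNˡ p (map (λ β → scaleN (sgn (suc k ℕ.∸ length β)) (hComp β)) (comps (suc k))) (M γ))
      (trans (∑-map (λ β → scaleN (sgn (suc k ℕ.∸ length β)) (hComp β)) (comps (suc k)) (λ a → pairing p a (M γ)))
      (trans (∑-cong (comps (suc k)) (λ β → trans (pairing-scaleNˡ p (sgn (suc k ℕ.∸ length β)) (hComp β) (M γ))
                                                   (cong (sgn (suc k ℕ.∸ length β) *_) (pairing-hComp-M β γ))))
      (trans (cong (λ l → ∑ l (λ β → sgn (suc k ℕ.∸ length β) * δ β γ)) (comps≡map-comp-vectors k))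
      (trans (∑-map comp (vectors k) _)
             (∑-vectors-cong k (λ y length≡k → cong (_* δ (comp y) γ) (sgn-njoin y k length≡k)))))))

module Intertwining (p : Comp → Comp → ℚ) (dual : IsDualPairing p) (perp : QSym → NSym → NSym) (isPerp : IsPerp p perp)
                    (ψ : NSym → NSym) (isPsi : IsPsi ψ) where

  open import Data.Integer using (+_; -[1+_]; _⊖_)
  open LinearFunctionals
  open NSymAlgebra
  open LinearOperators
  open Antidiagonals
  open Skewing p dual perp isPerp
  open Generators p dual perp isPerp
  open IsPsi isPsi renaming (resp to ψ-resp; add to ψ-+N; scale to ψ-scaleN; mult to ψ-*N; unit to ψ-oneN; onH to ψ-h)
  open Relation.Binary.Reasoning.Setoid ≈-setoid

  ψ-isLinear : IsLinear ψ
  ψ-isLinear = record { resp-≈ = λ {a} {b} a≈b → ψ-resp {a} {b} a≈b ; +N-homo = ψ-+N ; scaleN-homo = ψ-scaleN }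

  ψ-hComp : ∀ β → ψ (hComp β) ≈ word β
  ψ-hComp [] = ψ-oneN
  ψ-hComp (b ∷ β) = begin
    ψ (h (+ suc b) *N hComp β)        ≈⟨ ψ-*N (h (+ suc b)) (hComp β) ⟩
    ψ (h (+ suc b)) *N ψ (hComp β)    ≈⟨ *N-cong {ψ (h (+ suc b))} {e (+ suc b)} {ψ (hComp β)} {word β} (ψ-h (+ suc b)) (ψ-hComp β) ⟩
    word (b ∷ β)                      ∎

  ψ-e : ∀ n → ψ (e n) ≈ h n
  ψ-e -[1+ n ] = zeroN-homo ψ-isLinear
  ψ-e (+ zero) = ψ-oneN
  ψ-e (+ suc k) = begin
    ψ (e (+ suc k))                    ≈⟨ ψ-resp {e (+ suc k)} {signedHComps k} (e≈signedHComps k) ⟩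
    ψ (signedHComps k)                 ≈⟨ linear-sumN ψ-isLinear (comps (suc k)) (λ β → scaleN (sign β) (hComp β)) ⟩
    sumN (map (λ β → ψ (scaleN (sign β) (hComp β))) (comps (suc k)))
      ≈⟨ sumN-cong (comps (suc k)) (λ β w → trans (ψ-scaleN (sign β) (hComp β) w) (scaleN-cong (sign β) {ψ (hComp β)} {word β} (ψ-hComp β) w)) ⟩
    sumN (map (λ β → scaleN (sign β) (word β)) (comps (suc k)))
      ≈⟨ sumN-scaled-words (comps (suc k)) sign ⟩
    h (+ suc k)                        ∎
    where
    sign : Comp → ℚ
    sign β = sgn (suc k ℕ.∸ length β)

  ψ-perpOnes-e : ∀ n i → ψ (perpOnes i (e (+ n))) ≈ h (n ⊖ i)
  ψ-perpOnes-e n i w = trans (ψ-resp {perpOnes i (e (+ n))} {e (n ⊖ i)} (perpOnes-e n i) w) (ψ-e (n ⊖ i) w)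

  ψ-perpOnes-word : ∀ i w → ψ (perpOnes i (word w)) ≈ perpRow i (ψ (word w))
  ψ-perpOnes-word i [] = begin
    ψ (perpOnes i (e (+ 0)))          ≈⟨ ψ-perpOnes-e 0 i ⟩
    h (0 ⊖ i)                         ≈⟨ perpRow-h 0 i ⟨
    perpRow i (h (+ 0))               ≈⟨ perp-resp (F (row i)) {ψ oneN} {oneN} ψ-oneN ⟨
    perpRow i (ψ oneN)                ∎
  ψ-perpOnes-word i (k ∷ w) = begin
    ψ (perpOnes i (eₖ *N word w))
      ≈⟨ ψ-resp {perpOnes i (eₖ *N word w)} {sumN (map onesTerm (antidiagonal i))} (perpOnes-*N i eₖ (word w)) ⟩
    ψ (sumN (map onesTerm (antidiagonal i)))
      ≈⟨ linear-sumN ψ-isLinear (antidiagonal i) onesTerm ⟩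
    sumN (map (λ s → ψ (onesTerm s)) (antidiagonal i))
      ≈⟨ sumN-cong (antidiagonal i) (λ s w′ →
           trans (ψ-*N (perpOnes (proj₁ s) eₖ) (perpOnes (proj₂ s) (word w)) w′)
                 (*N-cong {ψ (perpOnes (proj₁ s) eₖ)} {h (suc k ⊖ proj₁ s)} {ψ (perpOnes (proj₂ s) (word w))} {perpRow (proj₂ s) (ψ (word w))}
                          (ψ-perpOnes-e (suc k) (proj₁ s)) (ψ-perpOnes-word (proj₂ s) w) w′)) ⟩
    sumN (map (λ s → h (suc k ⊖ proj₁ s) *N perpRow (proj₂ s) (ψ (word w))) (antidiagonal i))
      ≈⟨ sumN-cong (antidiagonal i) (λ s →
           *N-cong {perpRow (proj₁ s) (h (+ suc k))} {h (suc k ⊖ proj₁ s)} {perpRow (proj₂ s) (ψ (word w))} {perpRow (proj₂ s) (ψ (word w))}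
                   (perpRow-h (suc k) (proj₁ s)) (λ _ → refl)) ⟨
    sumN (map rowTerm (antidiagonal i))
      ≈⟨ perpRow-*N i (h (+ suc k)) (ψ (word w)) ⟨
    perpRow i (h (+ suc k) *N ψ (word w))
      ≈⟨ perp-resp (F (row i)) {ψ (word (k ∷ w))} {h (+ suc k) *N ψ (word w)} ψ-word-∷ ⟨
    perpRow i (ψ (word (k ∷ w)))      ∎
    where
    eₖ = e (+ suc k)
    onesTerm rowTerm : ℕ × ℕ → NSym
    onesTerm s = perpOnes (proj₁ s) eₖ *N perpOnes (proj₂ s) (word w)
    rowTerm s = perpRow (proj₁ s) (h (+ suc k)) *N perpRow (proj₂ s) (ψ (word w))
    ψ-word-∷ : ψ (word (k ∷ w)) ≈ h (+ suc k) *N ψ (word w)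
    ψ-word-∷ v = trans (ψ-*N eₖ (word w) v) (*N-cong {ψ eₖ} {h (+ suc k)} {ψ (word w)} {ψ (word w)} (ψ-e (+ suc k)) (λ _ → refl) v)

  -- Both sides are linear in x, so it suffices to check words.
  ψ-perpOnes : ∀ i x → ψ (perpOnes i x) ≈ perpRow i (ψ x)
  ψ-perpOnes i x = begin
    ψ (perpOnes i x)
      ≈⟨ linear-expand (∘-isLinear ψ-isLinear (perp-isLinear (F (ones i)))) x ⟩
    sumN (map (λ y → scaleN (proj₁ y) (ψ (perpOnes i (word (proj₂ y))))) x)
      ≈⟨ sumN-cong x (λ y → scaleN-cong (proj₁ y) {ψ (perpOnes i (word (proj₂ y)))} {perpRow i (ψ (word (proj₂ y)))}
                                        (ψ-perpOnes-word i (proj₂ y))) ⟩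
    sumN (map (λ y → scaleN (proj₁ y) (perpRow i (ψ (word (proj₂ y))))) x)
      ≈⟨ linear-expand (∘-isLinear (perp-isLinear (F (row i))) ψ-isLinear) x ⟨
    perpRow i (ψ x)                   ∎

  sumN-truncate : ∀ (f : ℕ → NSym) (g : ℕ → ℕ) N M → (∀ i → N ≤ i → f (g i) ≈ zeroN) → N ≤ M →
                  sumN (map f (applyUpTo g M)) ≈ sumN (map f (applyUpTo g N))
  sumN-truncate f g zero zero _ _ = λ _ → refl
  sumN-truncate f g zero (suc M) vanish _ w =
    trans (coeff-++ w (f (g 0)) (sumN (map f (applyUpTo (λ i → g (suc i)) M))))
          (cong₂ _+_ (vanish 0 z≤n w) (sumN-truncate f (λ i → g (suc i)) zero M (λ i _ → vanish (suc i) z≤n) z≤n w))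
  sumN-truncate f g (suc N) (suc M) vanish (s≤s N≤M) =
    +N-cong {f (g 0)} {f (g 0)} (λ _ → refl) (sumN-truncate f (λ i → g (suc i)) N M (λ i N≤i → vanish (suc i) (s≤s N≤i)) N≤M)

  -- The sums in 𝔹 and 𝔹rs are truncated at different degrees; both agree with the sum up to the larger one.
  ψ-𝔹 : ∀ m a b → ψ a ≈ b → ψ (𝔹 perp m a) ≈ 𝔹rs perp m b
  ψ-𝔹 m a b ψa≈b = begin
    ψ (𝔹 perp m a)
      ≈⟨ linear-sumN ψ-isLinear (upTo (suc (deg a))) (λ i → scaleN (sgn i) (h (m ℤ.+ + i) *N perpOnes i a)) ⟩
    sumN (map (λ i → ψ (scaleN (sgn i) (h (m ℤ.+ + i) *N perpOnes i a))) (upTo (suc (deg a))))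
      ≈⟨ sumN-cong (upTo (suc (deg a))) {λ i → ψ (scaleN (sgn i) (h (m ℤ.+ + i) *N perpOnes i a))} {term} ψ-term ⟩
    sumN (map term (upTo (suc (deg a))))
      ≈⟨ sumN-truncate term id (suc (deg a)) (suc (deg a ⊔ deg b)) (λ i a<i → term-vanish i (perpRow-kills-a i a<i)) (s≤s (ℕP.m≤m⊔n (deg a) (deg b))) ⟨
    sumN (map term (upTo (suc (deg a ⊔ deg b))))
      ≈⟨ sumN-truncate term id (suc (deg b)) (suc (deg a ⊔ deg b)) (λ i b<i → term-vanish i (perpRow-beyond-deg i b b<i)) (s≤s (ℕP.m≤n⊔m (deg a) (deg b))) ⟩
    𝔹rs perp m b                      ∎
    where
    id : ℕ → ℕ
    id i = i
    term : ℕ → NSym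
    term i = scaleN (sgn i) (e (m ℤ.+ + i) *N perpRow i b)
    ψ-perpOnes-a : ∀ i → ψ (perpOnes i a) ≈ perpRow i b
    ψ-perpOnes-a i w = trans (ψ-perpOnes i a w) (perp-resp (F (row i)) {ψ a} {b} ψa≈b w)
    ψ-term : ∀ i → ψ (scaleN (sgn i) (h (m ℤ.+ + i) *N perpOnes i a)) ≈ term i
    ψ-term i w =
      trans (ψ-scaleN (sgn i) _ w)
            (scaleN-cong (sgn i) {ψ (h (m ℤ.+ + i) *N perpOnes i a)} {e (m ℤ.+ + i) *N perpRow i b}
                         (λ v → trans (ψ-*N (h (m ℤ.+ + i)) (perpOnes i a) v)
                                      (*N-cong {ψ (h (m ℤ.+ + i))} {e (m ℤ.+ + i)} {ψ (perpOnes i a)} {perpRow i b}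
                                               (ψ-h (m ℤ.+ + i)) (ψ-perpOnes-a i) v)) w)
    perpRow-kills-a : ∀ i → suc (deg a) ≤ i → perpRow i b ≈ zeroN
    perpRow-kills-a i a<i w =
      trans (sym (ψ-perpOnes-a i w))
            (trans (ψ-resp {perpOnes i a} {zeroN} (perpOnes-beyond-deg i a a<i) w) (zeroN-homo ψ-isLinear w))
    term-vanish : ∀ i → perpRow i b ≈ zeroN → term i ≈ zeroN
    term-vanish i row≈0 = scaleN-*N-zeroʳ (sgn i) (e (m ℤ.+ + i)) row≈0

  ψ-applyAll : ∀ αs → ψ (foldr (𝔹 perp) oneN αs) ≈ foldr (𝔹rs perp) oneN αs
  ψ-applyAll [] = ψ-oneN
  ψ-applyAll (m ∷ αs) = ψ-𝔹 m (foldr (𝔹 perp) oneN αs) (foldr (𝔹rs perp) oneN αs) (ψ-applyAll αs)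

lemma3p16 : (p : Comp → Comp → ℚ) → IsDualPairing p →
            (perp : QSym → NSym → NSym) → IsPerp p perp →
            (ψ : NSym → NSym) → IsPsi ψ →
            (m : ℕ) → 1 ≤ m → (α : Vec ℤ m) →
            ψ (immaculate perp α) ≈ applyAll (𝔹rs perp) α
lemma3p16 p dual perp isPerp ψ isPsi m _ α = Intertwining.ψ-applyAll p dual perp isPerp ψ isPsi (Vec.toList α)
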